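{- Let $G$ be a connected graph of order $m$ and let $n$ be a positive integer. Then $$N(G\times P_n)\ \ge\ N_L(G\times P_n)\ =\ n\cdot N(G)+\sum_{k=2}^{n}(n-k+1)\cdot\left(\mathbf{1}^{T} A^{k-1}\mathbf{1}\right),$$ where $A=(a_{ij})_{i,j\in\{1,2,\dots,2^m-1\}}$ is defined as follows: fix a bijection $\phi$ from $\{1,2,\dots,2^m-1\}$ to the set of non-empty subsets of $V(G)$, and let $u,v$ be two adjacent vertices of a path; then $a_{ij}=1$ if $\{(p,u):p\in\phi(i)\}\cup\{(q,v):q\in\phi(j)\}$ is a connected set of $G\times P_2$ (equivalently, of $G\times P_n$ when $uv\in E(P_n)$), and $a_{ij}=0$ otherwise. Here $\mathbf{1}$ is the all-ones column vector of length $2^m-1$. Moreover, the equality $N(G\times P_n)=N_L(G\times P_n)$ holds only when $G$ is a complete graph or $n\in\{1,2\}$.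
   Context: All graphs are finite and simple. A connected set of a graph $H$ is a non-empty subset $C\subseteq V(H)$ such that the induced subgraph $H[C]$ is connected; $\mathcal{C}(H)$ denotes the set of all connected sets of $H$ and $N(H)=|\mathcal{C}(H)|$. $P_n$ is the path on $n$ vertices. The Cartesian product $G\times H$ has vertex set $V(G)\times V(H)$, with $(x_1,y_1)(x_2,y_2)$ an edge iff either $x_1x_2\in E(G)$ and $y_1=y_2$, or $y_1y_2\in E(H)$ and $x_1=x_2$. In $G\times P_n$, a column is the set of all vertices with a fixed second coordinate; two columns $X,Y$ are consecutive if their second coordinates are adjacent in $P_n$. $\mathcal{C}_L(G\times P_n)$ is the set of all $C\in\mathcal{C}(G\times P_n)$ such that for any two consecutive columns $X,Y$ with $X\cap C\neq\emptyset$ and $Y\cap C\neq\emptyset$, the set $C\cap(X\cup Y)$ is a connected set of $G\times P_n$. $N_L(G\times P_n)=|\mathcal{C}_L(G\times P_n)|$. -}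

module Defs where

open import Data.Nat using (ℕ; zero; suc; _+_; _*_; _∸_; _^_)
open import Data.Bool using (Bool; true; false; _∧_; _∨_; not; if_then_else_)
open import Data.Bool.Properties using () renaming (_≟_ to _≟b_)
open import Data.Fin using (Fin; toℕ; remQuot)
open import Data.Fin.Subset using (Subset)
open import Data.Vec using (Vec; []; _∷_; lookup; tabulate)
open import Data.List using (List; []; _∷_; map; filter; length; upTo; drop; allFin; concatMap)
open import Data.Bool.ListAction using (any; all)
open import Data.Nat.ListAction using (sum)
open import Data.Product using (_×_; _,_; proj₁; proj₂)
open import Relation.Binary.PropositionalEquality using (_≡_)
open import Relation.Nullary using (¬_)
open import Relation.Nullary.Decidable using (⌊_⌋)
import Data.Fin as F
import Data.Nat as N

Adj : ℕ → Set
Adj v = Fin v → Fin v → Bool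

mem : ∀ {v} → Subset v → Fin v → Bool
mem C x = lookup C x

-- reach E C k x y : there is a walk from x to y of length at most k
-- every step of which enters a vertex of C (so for x ∈ C it is a walk
-- in the induced subgraph H[C]).
reach : ∀ {v} → Adj v → Subset v → ℕ → Fin v → Fin v → Bool
reach E C zero    x y = ⌊ x F.≟ y ⌋
reach {v} E C (suc k) x y =
  reach E C k x y ∨ any (λ z → reach E C k x z ∧ E z y ∧ mem C y) (allFin v)

-- C is a connected set: C is non-empty and any two vertices of C are
-- joined by a walk inside C (a shortest such walk is a path, with at
-- most v - 1 edges, so length bound v loses nothing).
isConnectedSet : ∀ {v} → Adj v → Subset v → Bool
isConnectedSet {v} E C =
  any (mem C) (allFin v) ∧
  all (λ x → all (λ y → not (mem C x ∧ mem C y) ∨ reach E C v x y)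
                 (allFin v))
      (allFin v)

allSubsets : ∀ v → List (Subset v)
allSubsets zero    = [] ∷ []
allSubsets (suc v) = concatMap (λ s → (false ∷ s) ∷ (true ∷ s) ∷ []) (allSubsets v)

count : ∀ {v} → (Subset v → Bool) → ℕ
count {v} P = length (filter (λ C → P C ≟b true) (allSubsets v))

Ncs : ∀ {v} → Adj v → ℕ
Ncs E = count (isConnectedSet E)

record Graph : Set where
  field
    order  : ℕ
    adj    : Adj order
    sym    : ∀ x y → adj x y ≡ adj y x
    irrefl : ∀ x → adj x x ≡ false
open Graph public

N : Graph → ℕ
N G = Ncs (adj G)

IsConnected : Graph → Set
IsConnected G = isConnectedSet (adj G) (tabulate (λ _ → true)) ≡ true

IsComplete : Graph → Set
IsComplete G = ∀ x y → ¬ (x ≡ y) → adj G x y ≡ true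

-- The path P_n (vertices 0,…,n-1, i ~ j iff |i - j| = 1) and G × P_n.
-- A vertex (x , y) ∈ V(G) × V(P_n) is encoded as an element of
-- Fin (order G * n) via Data.Fin.combine; remQuot n decodes it.

pathAdj : ∀ n → Adj n
pathAdj n i j = ⌊ suc (toℕ i) N.≟ toℕ j ⌋ ∨ ⌊ suc (toℕ j) N.≟ toℕ i ⌋

prodAdj : (G : Graph) (n : ℕ) → Adj (order G * n)
prodAdj G n a b with remQuot {order G} n a | remQuot {order G} n b
... | (x₁ , y₁) | (x₂ , y₂) =
  (adj G x₁ x₂ ∧ ⌊ y₁ F.≟ y₂ ⌋) ∨ (⌊ x₁ F.≟ x₂ ⌋ ∧ pathAdj n y₁ y₂)

col : (G : Graph) (n : ℕ) → Fin (order G * n) → ℕ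
col G n a = toℕ (proj₂ (remQuot {order G} n a))

meets : (G : Graph) (n : ℕ) → Subset (order G * n) → ℕ → Bool
meets G n C c = any (λ a → mem C a ∧ ⌊ col G n a N.≟ c ⌋) (allFin (order G * n))

restrict2 : (G : Graph) (n : ℕ) → Subset (order G * n) → ℕ → Subset (order G * n)
restrict2 G n C c =
  tabulate (λ a → mem C a ∧ (⌊ col G n a N.≟ c ⌋ ∨ ⌊ col G n a N.≟ suc c ⌋))

isLConnectedSet : (G : Graph) (n : ℕ) → Subset (order G * n) → Bool
isLConnectedSet G n C =
  isConnectedSet (prodAdj G n) C ∧
  all (λ c → not (meets G n C c ∧ meets G n C (suc c))
             ∨ isConnectedSet (prodAdj G n) (restrict2 G n C c))
      (upTo n)

NProd : Graph → ℕ → ℕ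
NProd G n = Ncs (prodAdj G n)

NL : Graph → ℕ → ℕ
NL G n = count (isLConnectedSet G n)

-- φ is a bijection from Fin d (standing for {1,…,d}) onto the non-empty
-- subsets of V(G).
IsEnumeration : ∀ {m d} → (Fin d → Subset m) → Set
IsEnumeration {m} {d} φ =
  (∀ i → any (mem (φ i)) (allFin m) ≡ true) ×
  (∀ i j → φ i ≡ φ j → i ≡ j) ×
  (∀ (S : Subset m) → any (mem S) (allFin m) ≡ true →
     Data.Product.∃ (λ i → φ i ≡ S))

-- {(p,u) : p ∈ S} ∪ {(q,v) : q ∈ T} in G × P_2, with u = 0, v = 1.
twoColumns : (G : Graph) → Subset (order G) → Subset (order G) → Subset (order G * 2)
twoColumns G S T = tabulate λ a → f (remQuot {order G} 2 a)
  where
  f : Fin (order G) × Fin 2 → Bool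
  f (p , F.zero)  = mem S p
  f (p , F.suc _) = mem T p

matA : (G : Graph) {d : ℕ} → (Fin d → Subset (order G)) → Fin d → Fin d → ℕ
matA G φ i j =
  if isConnectedSet (prodAdj G 2) (twoColumns G (φ i) (φ j)) then 1 else 0

Mat : ℕ → Set
Mat d = Fin d → Fin d → ℕ

sumFin : ∀ {d} → (Fin d → ℕ) → ℕ
sumFin {d} f = sum (map f (allFin d))

idMat : ∀ {d} → Mat d
idMat i j = if ⌊ i F.≟ j ⌋ then 1 else 0

_⊗_ : ∀ {d} → Mat d → Mat d → Mat d
(M ⊗ M') i k = sumFin (λ j → M i j * M' j k)

_^^_ : ∀ {d} → Mat d → ℕ → Mat d
M ^^ zero  = idMat
M ^^ suc k = M ⊗ (M ^^ k)

onesForm : ∀ {d} → Mat d → ℕ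
onesForm M = sumFin (λ i → sumFin (λ j → M i j))

sumFromTo : ℕ → ℕ → (ℕ → ℕ) → ℕ
sumFromTo a b f = sum (map f (drop a (upTo (suc b))))

-- A subset C of G × P_n is determined by its columns C₀, …, C_{n-1}, and C ∈ 𝒞_L exactly when
-- its non-empty columns form an interval, consecutive non-empty columns are linked (their union
-- is connected in G × P₂), and a lone non-empty column is connected in G. Sets in a single
-- column contribute n · N(G). A run of k ≥ 2 non-empty columns is a walk of length k - 1 in the
-- graph on non-empty subsets of V(G) with adjacency matrix A, and it has n - k + 1 positions,
-- which gives the terms (n - k + 1) · 1ᵀ A^{k-1} 1. Since 𝒞_L ⊆ 𝒞, N_L ≤ N. If G is not complete
-- and n ≥ 3, an induced path x y z of G gives the connected set with columns {x, z}, {x, z},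
-- {x, y, z}, whose first two columns are not linked, so N_L < N.

module Submission where

open import Defs hiding (sym)
open import Data.Nat as ℕ using (ℕ; zero; suc; _+_; _*_; _∸_; _^_; _≤_; _<_; _≥_; z≤n; s≤s)
open import Data.Nat.Properties
open import Algebra.Properties.CommutativeSemigroup +-commutativeSemigroup using () renaming (interchange to +-interchange)
open import Data.Nat.ListAction using (sum)
open import Data.Nat.ListAction.Properties using (sum-++)
open import Data.Bool using (Bool; true; false; _∧_; _∨_; not; if_then_else_)
open import Data.Bool.Properties using (∧-identityʳ; ∧-zeroʳ; ∨-identityʳ; ∨-zeroʳ; ∨-comm; ∧-conicalˡ; ∧-conicalʳ)
import Data.Bool.Properties as Bool
open import Data.Bool.ListAction using (any; all)
open import Data.Fin as Fin using (Fin; toℕ; fromℕ<; combine; remQuot)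
open import Data.Fin.Properties
  using (all?; ¬∀⟶∃¬; remQuot-combine; combine-injective; combine-surjective; toℕ-injective; toℕ-fromℕ<; toℕ<n)
import Data.Fin.Properties as Finₚ
open import Data.Fin.Subset using (Subset; _⊆_; ∣_∣) renaming (⊥ to ∅; _∈_ to _∈ₛ_)
open import Data.Fin.Subset.Properties using (_∈?_; _⊂?_; ∉⊥; p⊂q⇒∣p∣<∣q∣; ∣p∣≤n; ∣⊥∣≡0)
open import Data.List using (List; []; _∷_; _++_; map; allFin; upTo; drop; concatMap; filter; length)
open import Data.List.Properties using (map-++; map-tabulate; upTo-∷ʳ; map-applyUpTo)
open import Data.List.Membership.Propositional using (_∈_)
open import Data.List.Membership.Propositional.Properties using (∈-allFin; ∈-upTo⁺; ∈-upTo⁻)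
open import Data.List.Relation.Unary.Any using (here; there)
open import Data.Vec using (Vec; []; _∷_; lookup; tabulate)
open import Data.Vec.Properties
  using (lookup∘tabulate; lookup-replicate; tabulate∘lookup; tabulate-cong; []=⇒lookup; lookup⇒[]=)
import Data.Vec.Properties as Vec
open import Data.Product using (∃; ∃₂; _×_; _,_; proj₁; proj₂)
open import Data.Sum using (_⊎_; inj₁; inj₂)
open import Function using (_∘_; _⇔_; mk⇔; _↔_; mk↔ₛ′; Inverse; Equivalence)
open import Function.Properties.Equivalence using () renaming (sym to ⇔-sym; trans to ⇔-trans)
open import Relation.Binary.Definitions using (DecidableEquality; tri<; tri≈; tri>)
open import Relation.Binary.PropositionalEquality
open import Relation.Nullary using (¬_; Dec; yes; no; contradiction; ¬?)
open import Relation.Nullary.Decidable using (⌊_⌋; _→-dec_)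

∨-true⁻ : ∀ a {b} → a ∨ b ≡ true → a ≡ true ⊎ b ≡ true
∨-true⁻ true  _ = inj₁ refl
∨-true⁻ false e = inj₂ e

∨-trueˡ : ∀ {a} b → a ≡ true → a ∨ b ≡ true
∨-trueˡ b refl = refl

∨-trueʳ : ∀ a {b} → b ≡ true → a ∨ b ≡ true
∨-trueʳ true  _ = refl
∨-trueʳ false e = e

∧-true⁺ : ∀ {a b} → a ≡ true → b ≡ true → a ∧ b ≡ true
∧-true⁺ refl refl = refl

implies⁻ : ∀ {a b c} → not (a ∧ b) ∨ c ≡ true → a ≡ true → b ≡ true → c ≡ true
implies⁻ e refl refl = e

implies⁺ : ∀ a b c → (a ≡ true → b ≡ true → c ≡ true) → not (a ∧ b) ∨ c ≡ true
implies⁺ true  true  _ h = h refl refl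
implies⁺ true  false _ _ = refl
implies⁺ false _     _ _ = refl

¬true⇒false : ∀ {b} → ¬ b ≡ true → b ≡ false
¬true⇒false {true}  h = contradiction refl h
¬true⇒false {false} _ = refl

true≢false : ¬ true ≡ false
true≢false ()

bool-ext : ∀ {a b : Bool} → (a ≡ true → b ≡ true) → (b ≡ true → a ≡ true) → a ≡ b
bool-ext {true}          f _ = sym (f refl)
bool-ext {false} {false} _ _ = refl
bool-ext {false} {true}  _ g = g refl

module _ {P : Set} where

  ⌊⌋-true⁺ : (d : Dec P) → P → ⌊ d ⌋ ≡ true
  ⌊⌋-true⁺ (yes _) _ = refl
  ⌊⌋-true⁺ (no ¬p) p = contradiction p ¬p

  ⌊⌋-true⁻ : (d : Dec P) → ⌊ d ⌋ ≡ true → P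
  ⌊⌋-true⁻ (yes p) _ = p

  ⌊⌋-false⁺ : (d : Dec P) → ¬ P → ⌊ d ⌋ ≡ false
  ⌊⌋-false⁺ (yes p) ¬p = contradiction p ¬p
  ⌊⌋-false⁺ (no _)  _  = refl

module _ {A : Set} (p : A → Bool) where

  any-true⁺ : ∀ {xs x} → x ∈ xs → p x ≡ true → any p xs ≡ true
  any-true⁺ {x ∷ _}  (here refl) e = ∨-trueˡ _ e
  any-true⁺ {y ∷ _}  (there x∈)  e = ∨-trueʳ (p y) (any-true⁺ x∈ e)

  any-true⁻ : ∀ xs → any p xs ≡ true → ∃ λ x → x ∈ xs × p x ≡ true
  any-true⁻ (x ∷ xs) e with ∨-true⁻ (p x) e
  ... | inj₁ px = x , here refl , px
  ... | inj₂ rest with any-true⁻ xs rest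
  ...   | y , y∈ , py = y , there y∈ , py

  any-false⁺ : ∀ xs → (∀ x → p x ≡ false) → any p xs ≡ false
  any-false⁺ []       _ = refl
  any-false⁺ (x ∷ xs) h rewrite h x = any-false⁺ xs h

  all-true⁺ : ∀ xs → (∀ x → x ∈ xs → p x ≡ true) → all p xs ≡ true
  all-true⁺ []       _ = refl
  all-true⁺ (x ∷ xs) h = ∧-true⁺ (h x (here refl)) (all-true⁺ xs (λ y y∈ → h y (there y∈)))

  all-true⁻ : ∀ {xs x} → all p xs ≡ true → x ∈ xs → p x ≡ true
  all-true⁻ {y ∷ _} e (here refl) = ∧-conicalˡ (p y) _ e
  all-true⁻ {y ∷ _} e (there x∈)  = all-true⁻ (∧-conicalʳ (p y) _ e) x∈

-- Walks and connected sets

module _ {v : ℕ} (E : Adj v) (C : Subset v) where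

  data Walk (x : Fin v) : Fin v → Set where
    []   : Walk x x
    step : ∀ {z y} → Walk x z → E z y ≡ true → mem C y ≡ true → Walk x y

  walkLength : ∀ {x y} → Walk x y → ℕ
  walkLength []           = 0
  walkLength (step w _ _) = suc (walkLength w)

  reach⇒Walk : ∀ k x y → reach E C k x y ≡ true → Walk x y
  reach⇒Walk zero x y e with ⌊⌋-true⁻ (x Fin.≟ y) e
  ... | refl = []
  reach⇒Walk (suc k) x y e with ∨-true⁻ (reach E C k x y) e
  ... | inj₁ r = reach⇒Walk k x y r
  ... | inj₂ r with any-true⁻ (λ z → reach E C k x z ∧ E z y ∧ mem C y) (allFin v) r
  ...   | z , _ , q =
    step (reach⇒Walk k x z (∧-conicalˡ _ _ q)) (∧-conicalˡ _ _ q′) (∧-conicalʳ (E z y) _ q′)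
    where
    q′ : (E z y ∧ mem C y) ≡ true
    q′ = ∧-conicalʳ (reach E C k x z) _ q

  reach-suc : ∀ k {x y} → reach E C k x y ≡ true → reach E C (suc k) x y ≡ true
  reach-suc k = ∨-trueˡ _

  Walk⇒reach-length : ∀ {x y} (w : Walk x y) → reach E C (walkLength w) x y ≡ true
  Walk⇒reach-length {x} []  = ⌊⌋-true⁺ (x Fin.≟ x) refl
  Walk⇒reach-length {x} {y} (step {z} w e m) =
    ∨-trueʳ (reach E C (walkLength w) x y)
      (any-true⁺ (λ z → reach E C (walkLength w) x z ∧ E z y ∧ mem C y) (∈-allFin z)
        (∧-true⁺ (Walk⇒reach-length w) (∧-true⁺ e m)))

  -- The sets reachable within k steps increase until they stabilise, and each strict
  -- increase adds a vertex, so nothing new becomes reachable after v steps.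
  module Saturation (x : Fin v) where

    reachable : ℕ → Subset v
    reachable k = tabulate (reach E C k x)

    reachable⁺ : ∀ k {y} → reach E C k x y ≡ true → y ∈ₛ reachable k
    reachable⁺ _ {y} r = lookup⇒[]= y _ (trans (lookup∘tabulate _ y) r)

    reachable⁻ : ∀ k {y} → y ∈ₛ reachable k → reach E C k x y ≡ true
    reachable⁻ _ {y} y∈ = trans (sym (lookup∘tabulate _ y)) ([]=⇒lookup y∈)

    reachable-suc : ∀ k → reachable k ⊆ reachable (suc k)
    reachable-suc k = reachable⁺ (suc k) ∘ reach-suc k ∘ reachable⁻ k

    reachable-step-mono : ∀ j k → reachable j ⊆ reachable k → reachable (suc j) ⊆ reachable (suc k)
    reachable-step-mono j k j⊆k {y} y∈ with ∨-true⁻ (reach E C j x y) (reachable⁻ (suc j) y∈)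
    ... | inj₁ r = reachable-suc k (j⊆k (reachable⁺ j r))
    ... | inj₂ r with any-true⁻ (λ z → reach E C j x z ∧ E z y ∧ mem C y) (allFin v) r
    ...   | z , z∈ , q = reachable⁺ (suc k) (∨-trueʳ (reach E C k x y)
              (any-true⁺ (λ z → reach E C k x z ∧ E z y ∧ mem C y) z∈
                (∧-true⁺ (reachable⁻ k (j⊆k (reachable⁺ j (∧-conicalˡ _ _ q))))
                         (∧-conicalʳ (reach E C j x z) _ q))))

    reachable-zero : ∀ k → reachable 0 ⊆ reachable k
    reachable-zero zero    y∈ = y∈
    reachable-zero (suc k) y∈ = reachable-suc k (reachable-zero k y∈)

    reachable-stable : ∀ k → reachable (suc k) ⊆ reachable k → ∀ j → reachable j ⊆ reachable k
    reachable-stable k _ zero    = reachable-zero k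
    reachable-stable k s (suc j) = s ∘ reachable-step-mono j k (reachable-stable k s j)

    reachable-grows : ∀ k → (∀ j → reachable j ⊆ reachable k) ⊎ k < ∣ reachable k ∣
    reachable-grows zero = inj₂ (subst (_< ∣ reachable 0 ∣) (∣⊥∣≡0 v)
      (p⊂q⇒∣p∣<∣q∣ ((λ y∈∅ → contradiction y∈∅ ∉⊥) , x , x∈R₀ , ∉⊥)))
      where
      x∈R₀ : x ∈ₛ reachable 0
      x∈R₀ = reachable⁺ 0 (⌊⌋-true⁺ (x Fin.≟ x) refl)
    reachable-grows (suc k) with reachable-grows k
    ... | inj₁ stable = inj₁ (λ j → reachable-suc k ∘ stable j)
    ... | inj₂ k<∣Rk∣ with reachable k ⊂? reachable (suc k)
    ...   | yes Rk⊂ = inj₂ (<-≤-trans (s≤s k<∣Rk∣) (p⊂q⇒∣p∣<∣q∣ Rk⊂))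
    ...   | no ¬Rk⊂ = inj₁ (λ j → reachable-suc k ∘ reachable-stable k shrink j)
      where
      shrink : reachable (suc k) ⊆ reachable k
      shrink {y} y∈ with y ∈? reachable k
      ... | yes y∈k = y∈k
      ... | no  y∉k = contradiction ((λ {z} → reachable-suc k {z}) , y , y∈ , y∉k) ¬Rk⊂

    reach-saturates : ∀ j {y} → reach E C j x y ≡ true → reach E C v x y ≡ true
    reach-saturates j r with reachable-grows v
    ... | inj₁ stable = reachable⁻ v (stable j (reachable⁺ j r))
    ... | inj₂ v<∣R∣  = contradiction (∣p∣≤n (reachable v)) (<⇒≱ v<∣R∣)

  Walk⇒reach : ∀ {x y} → Walk x y → reach E C v x y ≡ true
  Walk⇒reach {x} w = Saturation.reach-saturates x (walkLength w) (Walk⇒reach-length w)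

module _ {v : ℕ} {E : Adj v} {C : Subset v} where

  Walk-end : ∀ {x y} → Walk E C x y → mem C x ≡ true → mem C y ≡ true
  Walk-end []           x∈ = x∈
  Walk-end (step _ _ y∈) _ = y∈

  _++ʷ_ : ∀ {x y z} → Walk E C x y → Walk E C y z → Walk E C x z
  w ++ʷ []            = w
  w ++ʷ step w′ e z∈  = step (w ++ʷ w′) e z∈

  reverseʷ : (∀ a b → E a b ≡ E b a) → ∀ {x y} → mem C x ≡ true → Walk E C x y → Walk E C y x
  reverseʷ _   _  []                    = []
  reverseʷ sym-E x∈ (step {z} {y} w e _) =
    step [] (trans (sym-E y z) e) (Walk-end w x∈) ++ʷ reverseʷ sym-E x∈ w

Walk-⊆ : ∀ {v} {E : Adj v} {C C′ : Subset v} → (∀ a → mem C a ≡ true → mem C′ a ≡ true) →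
         ∀ {x y} → Walk E C x y → Walk E C′ x y
Walk-⊆ _   []            = []
Walk-⊆ C⊆C′ (step w e y∈) = step (Walk-⊆ C⊆C′ w) e (C⊆C′ _ y∈)

ConnectedSet : ∀ {v} → Adj v → Subset v → Set
ConnectedSet {v} E C =
  (∃ λ x → mem C x ≡ true) × (∀ x y → mem C x ≡ true → mem C y ≡ true → Walk E C x y)

module _ {v : ℕ} (E : Adj v) (C : Subset v) where

  isConnectedSet⇒ConnectedSet : isConnectedSet E C ≡ true → ConnectedSet E C
  isConnectedSet⇒ConnectedSet e with any-true⁻ (mem C) (allFin v) (∧-conicalˡ _ _ e)
  ... | x , _ , x∈ = (x , x∈) , λ a b a∈ b∈ →
    reach⇒Walk E C v a b (implies⁻ (all-true⁻ _ (row a) (∈-allFin b)) a∈ b∈)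
    where
    row : ∀ a → all (λ b → not (mem C a ∧ mem C b) ∨ reach E C v a b) (allFin v) ≡ true
    row a = all-true⁻ _ (∧-conicalʳ _ _ e) (∈-allFin a)

  ConnectedSet⇒isConnectedSet : ConnectedSet E C → isConnectedSet E C ≡ true
  ConnectedSet⇒isConnectedSet ((x , x∈) , walk) =
    ∧-true⁺ (any-true⁺ (mem C) (∈-allFin x) x∈)
      (all-true⁺ _ (allFin v) λ a _ → all-true⁺ _ (allFin v) λ b _ →
        implies⁺ (mem C a) (mem C b) _ (λ a∈ b∈ → Walk⇒reach E C (walk a b a∈ b∈)))

record InducedIsomorphism {v v′ : ℕ} (E : Adj v) (C : Subset v) (E′ : Adj v′) (C′ : Subset v′) : Set where
  field
    f           : Fin v′ → Fin v
    f-injective : ∀ a b → f a ≡ f b → a ≡ b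
    mem-f       : ∀ a → mem C (f a) ≡ mem C′ a
    f-onto      : ∀ b → mem C b ≡ true → ∃ λ a → f a ≡ b
    adj-f       : ∀ a b → mem C′ a ≡ true → mem C′ b ≡ true → E (f a) (f b) ≡ E′ a b

module _ {v v′ : ℕ} {E : Adj v} {C : Subset v} {E′ : Adj v′} {C′ : Subset v′}
         (iso : InducedIsomorphism E C E′ C′) where
  open InducedIsomorphism iso

  private
    mem-f⁻ : ∀ {a} → mem C (f a) ≡ true → mem C′ a ≡ true
    mem-f⁻ {a} = trans (sym (mem-f a))

    mem-f⁺ : ∀ {a} → mem C′ a ≡ true → mem C (f a) ≡ true
    mem-f⁺ {a} = trans (mem-f a)

    push : ∀ {a b} → mem C′ a ≡ true → Walk E′ C′ a b → Walk E C (f a) (f b)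
    push _  []                       = []
    push a∈ (step {z} {y} w e y∈) = step (push a∈ w) (trans (adj-f z y (Walk-end w a∈) y∈) e) (mem-f⁺ y∈)

    pull : ∀ {s t} → Walk E C s t → ∀ a → f a ≡ s → mem C′ a ≡ true →
           ∃ λ b → f b ≡ t × Walk E′ C′ a b
    pull []                  a fa≡s _  = a , fa≡s , []
    pull (step {y = y} w e y∈) a fa≡s a∈ with pull w a fa≡s a∈
    ... | b , refl , w′ with f-onto y y∈
    ...   | c , refl = c , refl , step w′ (trans (sym (adj-f b c (Walk-end w′ a∈) (mem-f⁻ y∈))) e) (mem-f⁻ y∈)

  ConnectedSet-transport : ConnectedSet E′ C′ ⇔ ConnectedSet E C
  ConnectedSet-transport = mk⇔ to from
    where
    to : ConnectedSet E′ C′ → ConnectedSet E C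
    to ((a , a∈) , walk) = (f a , mem-f⁺ a∈) , λ x y x∈ y∈ → go (f-onto x x∈) (f-onto y y∈) x∈ y∈
      where
      go : ∀ {x y} → (∃ λ a → f a ≡ x) → (∃ λ b → f b ≡ y) →
           mem C x ≡ true → mem C y ≡ true → Walk E C x y
      go (a , refl) (b , refl) x∈ y∈ = push (mem-f⁻ x∈) (walk a b (mem-f⁻ x∈) (mem-f⁻ y∈))
    from : ConnectedSet E C → ConnectedSet E′ C′
    from ((x , x∈) , walk) with f-onto x x∈
    ... | a₀ , refl = (a₀ , mem-f⁻ x∈) , go
      where
      go : ∀ a b → mem C′ a ≡ true → mem C′ b ≡ true → Walk E′ C′ a b
      go a b a∈ b∈ with pull (walk (f a) (f b) (mem-f⁺ a∈) (mem-f⁺ b∈)) a refl a∈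
      ... | b′ , fb′≡fb , w with f-injective b′ b fb′≡fb
      ...   | refl = w

  isConnectedSet-transport : isConnectedSet E′ C′ ≡ isConnectedSet E C
  isConnectedSet-transport = bool-ext
    (ConnectedSet⇒isConnectedSet E C ∘ Equivalence.to ConnectedSet-transport ∘ isConnectedSet⇒ConnectedSet E′ C′)
    (ConnectedSet⇒isConnectedSet E′ C′ ∘ Equivalence.from ConnectedSet-transport ∘ isConnectedSet⇒ConnectedSet E C)

-- Sums and enumerations

∑ : ∀ {A : Set} → List A → (A → ℕ) → ℕ
∑ xs f = sum (map f xs)

𝟙 : Bool → ℕ
𝟙 b = if b then 1 else 0

module _ {A : Set} where

  ∑-++ : ∀ (xs ys : List A) f → ∑ (xs ++ ys) f ≡ ∑ xs f + ∑ ys f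
  ∑-++ xs ys f = trans (cong sum (map-++ f xs ys)) (sum-++ (map f xs) (map f ys))

  ∑-cong : ∀ xs {f g : A → ℕ} → (∀ x → f x ≡ g x) → ∑ xs f ≡ ∑ xs g
  ∑-cong []       _   = refl
  ∑-cong (x ∷ xs) f≗g = cong₂ _+_ (f≗g x) (∑-cong xs f≗g)

  ∑-cong-∈ : ∀ xs {f g : A → ℕ} → (∀ x → x ∈ xs → f x ≡ g x) → ∑ xs f ≡ ∑ xs g
  ∑-cong-∈ []       _   = refl
  ∑-cong-∈ (x ∷ xs) f≗g = cong₂ _+_ (f≗g x (here refl)) (∑-cong-∈ xs (λ y y∈ → f≗g y (there y∈)))

  ∑-zero : ∀ xs (f : A → ℕ) → (∀ x → f x ≡ 0) → ∑ xs f ≡ 0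
  ∑-zero []       _ _  = refl
  ∑-zero (x ∷ xs) f f≡0 rewrite f≡0 x = ∑-zero xs f f≡0

  ∑-+ : ∀ xs (f g : A → ℕ) → ∑ xs (λ x → f x + g x) ≡ ∑ xs f + ∑ xs g
  ∑-+ []       _ _ = refl
  ∑-+ (x ∷ xs) f g rewrite ∑-+ xs f g = +-interchange (f x) (g x) (∑ xs f) (∑ xs g)

  ∑-*ˡ : ∀ xs c (f : A → ℕ) → ∑ xs (λ x → c * f x) ≡ c * ∑ xs f
  ∑-*ˡ []       c _ = sym (*-zeroʳ c)
  ∑-*ˡ (x ∷ xs) c f rewrite ∑-*ˡ xs c f = sym (*-distribˡ-+ c (f x) _)

  ∑-*ʳ : ∀ xs c (f : A → ℕ) → ∑ xs (λ x → f x * c) ≡ ∑ xs f * c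
  ∑-*ʳ []       _ _ = refl
  ∑-*ʳ (x ∷ xs) c f rewrite ∑-*ʳ xs c f = sym (*-distribʳ-+ c (f x) _)

  ∑-mono-≤ : ∀ xs {f g : A → ℕ} → (∀ x → f x ≤ g x) → ∑ xs f ≤ ∑ xs g
  ∑-mono-≤ []       _   = z≤n
  ∑-mono-≤ (x ∷ xs) f≤g = +-mono-≤ (f≤g x) (∑-mono-≤ xs f≤g)

  ∑-mono-< : ∀ xs {y} {f g : A → ℕ} → (∀ x → f x ≤ g x) → y ∈ xs → f y < g y → ∑ xs f < ∑ xs g
  ∑-mono-< (_ ∷ xs) f≤g (here refl) fy<gy = +-mono-<-≤ fy<gy (∑-mono-≤ xs f≤g)
  ∑-mono-< (x ∷ xs) f≤g (there y∈)  fy<gy = +-mono-≤-< (f≤g x) (∑-mono-< xs f≤g y∈ fy<gy)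

module _ {A B : Set} where

  ∑-map : ∀ (g : A → B) xs f → ∑ (map g xs) f ≡ ∑ xs (f ∘ g)
  ∑-map g []       _ = refl
  ∑-map g (x ∷ xs) f = cong (f (g x) +_) (∑-map g xs f)

  ∑-concatMap : ∀ (g : A → List B) xs f → ∑ (concatMap g xs) f ≡ ∑ xs (λ x → ∑ (g x) f)
  ∑-concatMap g []       _ = refl
  ∑-concatMap g (x ∷ xs) f = trans (∑-++ (g x) (concatMap g xs) f) (cong (∑ (g x) f +_) (∑-concatMap g xs f))

  ∑-comm : ∀ xs ys (F : A → B → ℕ) → ∑ xs (λ x → ∑ ys (F x)) ≡ ∑ ys (λ y → ∑ xs (λ x → F x y))
  ∑-comm []       ys _ = sym (∑-zero ys _ (λ _ → refl))
  ∑-comm (x ∷ xs) ys F rewrite ∑-comm xs ys F = sym (∑-+ ys (F x) (λ y → ∑ xs (λ x → F x y)))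

∑-allFin-suc : ∀ {d} (f : Fin (suc d) → ℕ) → ∑ (allFin (suc d)) f ≡ f Fin.zero + ∑ (allFin d) (f ∘ Fin.suc)
∑-allFin-suc {d} f = cong (f Fin.zero +_)
  (trans (cong (λ l → ∑ l f) (sym (map-tabulate (λ i → i) Fin.suc))) (∑-map Fin.suc (allFin d) f))

count≡∑ : ∀ {v} (P : Subset v → Bool) → count P ≡ ∑ (allSubsets v) (𝟙 ∘ P)
count≡∑ {v} P = go (allSubsets v)
  where
  go : ∀ xs → length (filter (λ C → P C Bool.≟ true) xs) ≡ ∑ xs (𝟙 ∘ P)
  go []       = refl
  go (x ∷ xs) with P x
  ... | true  = cong suc (go xs)
  ... | false = go xs

𝟙-∧ : ∀ a b → 𝟙 (a ∧ b) ≡ 𝟙 a * 𝟙 b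
𝟙-∧ true  b = sym (+-identityʳ (𝟙 b))
𝟙-∧ false b = refl

𝟙-∧-≤ : ∀ a b → 𝟙 (a ∧ b) ≤ 𝟙 a
𝟙-∧-≤ true  true  = ≤-refl
𝟙-∧-≤ true  false = z≤n
𝟙-∧-≤ false _     = z≤n

𝟙-if : ∀ b x y → 𝟙 (if b then x else y) ≡ 𝟙 b * 𝟙 x + 𝟙 (not b) * 𝟙 y
𝟙-if true  x y = sym (trans (cong (_+ 0) (+-identityʳ (𝟙 x))) (+-identityʳ (𝟙 x)))
𝟙-if false x y = sym (+-identityʳ (𝟙 y))

∑-upTo-suc : ∀ k (f : ℕ → ℕ) → ∑ (upTo (suc k)) f ≡ f 0 + ∑ (upTo k) (f ∘ suc)
∑-upTo-suc k f = cong (f 0 +_) (trans (cong sum (map-applyUpTo suc f k))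
                                     (sym (cong sum (map-applyUpTo (λ i → i) (f ∘ suc) k))))

∑-upTo-∷ʳ : ∀ k (f : ℕ → ℕ) → ∑ (upTo (suc k)) f ≡ ∑ (upTo k) f + f k
∑-upTo-∷ʳ k f = trans (cong (λ l → ∑ l f) (sym (upTo-∷ʳ k)))
  (trans (∑-++ (upTo k) (k ∷ []) f) (cong (∑ (upTo k) f +_) (+-identityʳ (f k))))

∈-drop⁻ : ∀ {A : Set} k (xs : List A) {x} → x ∈ drop k xs → x ∈ xs
∈-drop⁻ zero    _        x∈ = x∈
∈-drop⁻ (suc k) (_ ∷ xs) x∈ = there (∈-drop⁻ k xs x∈)

module Multiplicity {A : Set} (_≟_ : DecidableEquality A) where

  δ : A → A → ℕ
  δ x y = 𝟙 ⌊ x ≟ y ⌋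

  δ-refl : ∀ x → δ x x ≡ 1
  δ-refl x with x ≟ x
  ... | yes _   = refl
  ... | no x≢x = contradiction refl x≢x

  δ-≢ : ∀ {x y} → ¬ x ≡ y → δ x y ≡ 0
  δ-≢ {x} {y} x≢y with x ≟ y
  ... | yes x≡y = contradiction x≡y x≢y
  ... | no _    = refl

  δ-sym : ∀ x y → δ x y ≡ δ y x
  δ-sym x y with x ≟ y | y ≟ x
  ... | yes _   | yes _   = refl
  ... | no _    | no _    = refl
  ... | yes x≡y | no y≢x  = contradiction (sym x≡y) y≢x
  ... | no x≢y  | yes y≡x = contradiction (sym y≡x) x≢y

  δ-* : ∀ x y (h : A → ℕ) → δ x y * h y ≡ δ x y * h x
  δ-* x y h with x ≟ y
  ... | yes refl = refl
  ... | no _     = refl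

  multiplicity : A → List A → ℕ
  multiplicity y xs = ∑ xs (λ x → δ x y)

  Enumerates : List A → Set
  Enumerates xs = ∀ y → multiplicity y xs ≡ 1

  ∑-δ : ∀ x ys (h : A → ℕ) → ∑ ys (λ y → δ x y * h y) ≡ multiplicity x ys * h x
  ∑-δ x ys h = trans (∑-cong ys (λ y → trans (δ-* x y h) (cong (_* h x) (δ-sym x y))))
                     (∑-*ʳ ys (h x) (λ y → δ y x))

  ∑-by-multiplicity : ∀ U → Enumerates U → ∀ xs (h : A → ℕ) →
                      ∑ xs h ≡ ∑ U (λ y → multiplicity y xs * h y)
  ∑-by-multiplicity U U-enum xs h = begin
    ∑ xs h                                     ≡⟨ ∑-cong xs (λ x → sym (one-term x)) ⟩
    ∑ xs (λ x → ∑ U (λ y → δ x y * h y))      ≡⟨ ∑-comm xs U _ ⟩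
    ∑ U (λ y → ∑ xs (λ x → δ x y * h y))      ≡⟨ ∑-cong U (λ y → ∑-*ʳ xs (h y) (λ x → δ x y)) ⟩
    ∑ U (λ y → multiplicity y xs * h y)        ∎
    where
    open ≡-Reasoning
    one-term : ∀ x → ∑ U (λ y → δ x y * h y) ≡ h x
    one-term x = trans (∑-δ x U h) (trans (cong (_* h x) (U-enum x)) (+-identityʳ (h x)))

  ∑-enumeration : ∀ U xs → Enumerates U → Enumerates xs → (h : A → ℕ) → ∑ xs h ≡ ∑ U h
  ∑-enumeration U xs U-enum xs-enum h =
    trans (∑-by-multiplicity U U-enum xs h) (∑-cong U (λ y → trans (cong (_* h y) (xs-enum y)) (+-identityʳ (h y))))

  multiplicity-pos⇒∈ : ∀ {y} xs → 1 ≤ multiplicity y xs → y ∈ xs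
  multiplicity-pos⇒∈ {y} (x ∷ xs) pos with x ≟ y
  ... | yes refl = here refl
  ... | no _     = there (multiplicity-pos⇒∈ xs pos)

  Enumerates⇒∈ : ∀ {xs} → Enumerates xs → ∀ y → y ∈ xs
  Enumerates⇒∈ {xs} xs-enum y = multiplicity-pos⇒∈ xs (≤-reflexive (sym (xs-enum y)))

module _ {A B : Set} (_≟A_ : DecidableEquality A) (_≟B_ : DecidableEquality B) where
  private
    module MA = Multiplicity _≟A_
    module MB = Multiplicity _≟B_

  δ-cong : ∀ a a′ b b′ → (a ≡ a′ → b ≡ b′) → (b ≡ b′ → a ≡ a′) → MA.δ a a′ ≡ MB.δ b b′
  δ-cong a a′ b b′ to from with a ≟A a′ | b ≟B b′
  ... | yes _ | yes _ = refl
  ... | no _  | no _  = refl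
  ... | yes p | no q  = contradiction (to p) q
  ... | no p  | yes q = contradiction (from q) p

  map-enumerates : (g : A ↔ B) → ∀ {U} → MA.Enumerates U → MB.Enumerates (map (Inverse.to g) U)
  map-enumerates g {U} U-enum b = trans (∑-map to U (λ x → MB.δ x b))
    (trans (∑-cong U (λ a → sym (δ-cong a (from b) (to a) b
                                       (λ a≡ → trans (cong to a≡) (inverseˡ refl))
                                       (λ ≡b → trans (sym (inverseʳ refl)) (cong from ≡b)))))
           (U-enum (from b)))
    where open Inverse g

module _ {A : Set} (_≟_ : DecidableEquality A) where
  private
    module M = Multiplicity _≟_
    module Mᵥ {n} = Multiplicity (Vec.≡-dec {n = n} _≟_)

  δ-∷ : ∀ {n} x y (xs ys : Vec A n) → Mᵥ.δ (x ∷ xs) (y ∷ ys) ≡ M.δ x y * Mᵥ.δ xs ys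
  δ-∷ x y xs ys with Vec.≡-dec _≟_ (x ∷ xs) (y ∷ ys) | x ≟ y | Vec.≡-dec _≟_ xs ys
  ... | yes _    | yes _    | yes _    = refl
  ... | yes refl | no x≢x   | _        = contradiction refl x≢x
  ... | yes refl | yes _    | no xs≢xs = contradiction refl xs≢xs
  ... | no _     | no _     | _        = refl
  ... | no _     | yes _    | no _     = refl
  ... | no ≢     | yes refl | yes refl = contradiction refl ≢

  allVecs : List A → ∀ n → List (Vec A n)
  allVecs U zero    = [] ∷ []
  allVecs U (suc n) = concatMap (λ x → map (x ∷_) (allVecs U n)) U

  ∑-allVecs-suc : ∀ U n (h : Vec A (suc n) → ℕ) →
                  ∑ (allVecs U (suc n)) h ≡ ∑ U (λ x → ∑ (allVecs U n) (h ∘ (x ∷_)))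
  ∑-allVecs-suc U n h = trans (∑-concatMap _ U h) (∑-cong U (λ x → ∑-map (x ∷_) (allVecs U n) h))

  allVecs-enumerates : ∀ {U} → M.Enumerates U → ∀ n → Mᵥ.Enumerates (allVecs U n)
  allVecs-enumerates _ zero [] = refl
  allVecs-enumerates {U} U-enum (suc n) (y ∷ ys) = begin
    ∑ (allVecs U (suc n)) (λ xs → Mᵥ.δ xs (y ∷ ys))                ≡⟨ ∑-allVecs-suc U n _ ⟩
    ∑ U (λ x → ∑ (allVecs U n) (λ xs → Mᵥ.δ (x ∷ xs) (y ∷ ys)))    ≡⟨ ∑-cong U factor ⟩
    ∑ U (λ x → M.δ x y * 1)                                          ≡⟨ ∑-*ʳ U 1 (λ x → M.δ x y) ⟩
    M.multiplicity y U * 1                                           ≡⟨ cong (_* 1) (U-enum y) ⟩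
    1                                                                ∎
    where
    open ≡-Reasoning
    factor : ∀ x → ∑ (allVecs U n) (λ xs → Mᵥ.δ (x ∷ xs) (y ∷ ys)) ≡ M.δ x y * 1
    factor x = trans (∑-cong (allVecs U n) (λ xs → δ-∷ x y xs ys))
      (trans (∑-*ˡ (allVecs U n) (M.δ x y) (λ xs → Mᵥ.δ xs ys))
             (cong (M.δ x y *_) (allVecs-enumerates U-enum n ys)))

allFin-enumerates : ∀ d → Multiplicity.Enumerates (Fin._≟_ {d}) (allFin d)
allFin-enumerates (suc d) Fin.zero = trans (∑-allFin-suc (λ x → δ x Fin.zero))
  (cong₂ _+_ (δ-refl Fin.zero) (∑-zero (allFin d) _ (λ j → δ-≢ {Fin.suc j} {Fin.zero} (λ ()))))
  where open Multiplicity (Fin._≟_ {suc d})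
allFin-enumerates (suc d) (Fin.suc i) = trans (∑-allFin-suc (λ x → δ x (Fin.suc i)))
  (trans (cong₂ _+_ (δ-≢ {Fin.zero} {Fin.suc i} (λ ())) (∑-cong (allFin d) δ-suc)) (allFin-enumerates d i))
  where
  open Multiplicity (Fin._≟_ {suc d})
  δ-suc : ∀ j → δ (Fin.suc j) (Fin.suc i) ≡ Multiplicity.δ Fin._≟_ j i
  δ-suc j = δ-cong Fin._≟_ Fin._≟_ (Fin.suc j) (Fin.suc i) j i Finₚ.suc-injective (cong Fin.suc)

_≟ₛ_ : ∀ {v} → DecidableEquality (Subset v)
_≟ₛ_ = Vec.≡-dec Bool._≟_

allSubsets-enumerates : ∀ v → Multiplicity.Enumerates (_≟ₛ_ {v}) (allSubsets v)
allSubsets-enumerates zero    [] = refl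
allSubsets-enumerates (suc v) (b ∷ S) = trans (∑-concatMap _ (allSubsets v) _)
  (trans (∑-cong (allSubsets v) both-heads) (allSubsets-enumerates v S))
  where
  open Multiplicity (_≟ₛ_ {v})
  module M′ = Multiplicity (_≟ₛ_ {suc v})
  both-heads : ∀ s → M′.δ (false ∷ s) (b ∷ S) + (M′.δ (true ∷ s) (b ∷ S) + 0) ≡ δ s S
  both-heads s rewrite δ-∷ Bool._≟_ false b s S | δ-∷ Bool._≟_ true b s S = one-head b (δ s S)
    where
    one-head : ∀ b k → 𝟙 ⌊ false Bool.≟ b ⌋ * k + (𝟙 ⌊ true Bool.≟ b ⌋ * k + 0) ≡ k
    one-head false k = trans (+-identityʳ _) (+-identityʳ k)
    one-head true  k = trans (+-identityʳ _) (+-identityʳ k)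

-- The product G × P_n and its columns

coordinates : ∀ {m n} (a : Fin (m * n)) → ∃₂ λ x y → a ≡ combine x y
coordinates {m} {n} a with combine-surjective {m} {n} a
... | x , y , e = x , y , sym e

nonempty : ∀ {k} → Subset k → Bool
nonempty {k} S = any (mem S) (allFin k)

nonempty⁺ : ∀ {k} (S : Subset k) x → mem S x ≡ true → nonempty S ≡ true
nonempty⁺ S x = any-true⁺ (mem S) (∈-allFin x)

nonempty⁻ : ∀ {k} (S : Subset k) → nonempty S ≡ true → ∃ λ x → mem S x ≡ true
nonempty⁻ {k} S e with any-true⁻ _ (allFin k) e
... | x , _ , x∈ = x , x∈

nonempty-∅ : ∀ {k} → nonempty (∅ {k}) ≡ false
nonempty-∅ {k} = any-false⁺ (mem ∅) (allFin k) (λ x → lookup-replicate x false)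

module _ (G : Graph) (n : ℕ) where

  cartesianAdj : Fin (order G) × Fin n → Fin (order G) × Fin n → Bool
  cartesianAdj (x₁ , y₁) (x₂ , y₂) =
    (adj G x₁ x₂ ∧ ⌊ y₁ Fin.≟ y₂ ⌋) ∨ (⌊ x₁ Fin.≟ x₂ ⌋ ∧ pathAdj n y₁ y₂)

  prodAdj-combine : ∀ x x′ y y′ → prodAdj G n (combine x y) (combine x′ y′) ≡ cartesianAdj (x , y) (x′ , y′)
  prodAdj-combine x x′ y y′ = cong₂ cartesianAdj (remQuot-combine x y) (remQuot-combine x′ y′)

  col-combine : ∀ x y → col G n (combine x y) ≡ toℕ y
  col-combine x y = cong (λ p → toℕ (proj₂ p)) (remQuot-combine {order G} {n} x y)

  prodAdj-sym : ∀ a b → prodAdj G n a b ≡ prodAdj G n b a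
  prodAdj-sym a b with coordinates {order G} {n} a | coordinates {order G} {n} b
  ... | x , y , refl | x′ , y′ , refl = begin
    prodAdj G n (combine x y) (combine x′ y′) ≡⟨ prodAdj-combine x x′ y y′ ⟩
    cartesianAdj (x , y) (x′ , y′)            ≡⟨ cong₂ _∨_ (cong₂ _∧_ (Graph.sym G x x′) (⌊≟⌋-sym y y′))
                                                           (cong₂ _∧_ (⌊≟⌋-sym x x′) (∨-comm ⌊ suc (toℕ y) ℕ.≟ toℕ y′ ⌋ _)) ⟩
    cartesianAdj (x′ , y′) (x , y)            ≡⟨ sym (prodAdj-combine x′ x y′ y) ⟩
    prodAdj G n (combine x′ y′) (combine x y) ∎
    where
    open ≡-Reasoning
    ⌊≟⌋-sym : ∀ {k} (i j : Fin k) → ⌊ i Fin.≟ j ⌋ ≡ ⌊ j Fin.≟ i ⌋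
    ⌊≟⌋-sym i j = bool-ext (λ e → ⌊⌋-true⁺ (j Fin.≟ i) (sym (⌊⌋-true⁻ (i Fin.≟ j) e)))
                           (λ e → ⌊⌋-true⁺ (i Fin.≟ j) (sym (⌊⌋-true⁻ (j Fin.≟ i) e)))

  prodAdj⇒col≤suc : ∀ a b → prodAdj G n a b ≡ true → col G n b ≤ suc (col G n a)
  prodAdj⇒col≤suc a b e with coordinates {order G} {n} a | coordinates {order G} {n} b
  ... | x , y , refl | x′ , y′ , refl =
    subst₂ (λ i j → i ≤ suc j) (sym (col-combine x′ y′)) (sym (col-combine x y))
      (cases (∨-true⁻ _ (trans (sym (prodAdj-combine x x′ y y′)) e)))
    where
    cases : (adj G x x′ ∧ ⌊ y Fin.≟ y′ ⌋) ≡ true ⊎ (⌊ x Fin.≟ x′ ⌋ ∧ pathAdj n y y′) ≡ true →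
            toℕ y′ ≤ suc (toℕ y)
    cases (inj₁ horizontal) with ⌊⌋-true⁻ (y Fin.≟ y′) (∧-conicalʳ (adj G x x′) _ horizontal)
    ... | refl = n≤1+n _
    cases (inj₂ vertical) with ∨-true⁻ _ (∧-conicalʳ ⌊ x Fin.≟ x′ ⌋ _ vertical)
    ... | inj₁ up   = ≤-reflexive (sym (⌊⌋-true⁻ (suc (toℕ y) ℕ.≟ toℕ y′) up))
    ... | inj₂ down =
      ≤-trans (≤-trans (n≤1+n _) (≤-reflexive (⌊⌋-true⁻ (suc (toℕ y′) ℕ.≟ toℕ y) down))) (n≤1+n _)

  -- Each step of a walk changes the column by at most one.
  Walk-visits-columns : ∀ {C a b} → Walk (prodAdj G n) C a b → mem C a ≡ true →
                        ∀ c → col G n a ≤ c → c ≤ col G n b → ∃ λ z → mem C z ≡ true × col G n z ≡ c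
  Walk-visits-columns [] a∈ c a≤c c≤b = _ , a∈ , ≤-antisym a≤c c≤b
  Walk-visits-columns {b = b} (step {z} w e b∈) a∈ c a≤c c≤b with c ℕ.≟ col G n b
  ... | yes c≡b = b , b∈ , sym c≡b
  ... | no  c≢b = Walk-visits-columns w a∈ c a≤c (≤-pred (≤-trans (≤∧≢⇒< c≤b c≢b) (prodAdj⇒col≤suc z b e)))

pathAdj-irrefl : ∀ n (y : Fin n) → pathAdj n y y ≡ false
pathAdj-irrefl n y rewrite ⌊⌋-false⁺ (suc (toℕ y) ℕ.≟ toℕ y) 1+n≢n = refl

lookupᵈ : ∀ {A : Set} {n} → A → Vec A n → ℕ → A
lookupᵈ d []       _       = d
lookupᵈ d (x ∷ _)  zero    = x
lookupᵈ d (_ ∷ xs) (suc c) = lookupᵈ d xs c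

lookupᵈ-toℕ : ∀ {A : Set} {n} (d : A) (xs : Vec A n) i → lookupᵈ d xs (toℕ i) ≡ lookup xs i
lookupᵈ-toℕ d (x ∷ _)  Fin.zero    = refl
lookupᵈ-toℕ d (_ ∷ xs) (Fin.suc i) = lookupᵈ-toℕ d xs i

lookupᵈ-≥ : ∀ {A : Set} {n} (d : A) (xs : Vec A n) c → n ≤ c → lookupᵈ d xs c ≡ d
lookupᵈ-≥ d []       _       _       = refl
lookupᵈ-≥ d (_ ∷ xs) (suc c) (s≤s p) = lookupᵈ-≥ d xs c p

connected : (G : Graph) → Subset (order G) → Bool
connected G = isConnectedSet (adj G)

linked : (G : Graph) → Subset (order G) → Subset (order G) → Bool
linked G S T = isConnectedSet (prodAdj G 2) (twoColumns G S T)

-- twoColumns is a tabulate of a local function, which matching V ≡ tabulate f lets us name.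
lookup-tabulate : ∀ {A : Set} {k} {V : Vec A k} {f : Fin k → A} → V ≡ tabulate f → ∀ i → lookup V i ≡ f i
lookup-tabulate refl = lookup∘tabulate _

module _ (G : Graph) (S T : Subset (order G)) (x : Fin (order G)) where

  mem-twoColumns₀ : mem (twoColumns G S T) (combine x Fin.zero) ≡ mem S x
  mem-twoColumns₀ rewrite lookup-tabulate {V = twoColumns G S T} refl (combine x Fin.zero)
                        | remQuot-combine {order G} {2} x Fin.zero = refl

  mem-twoColumns₁ : mem (twoColumns G S T) (combine x (Fin.suc Fin.zero)) ≡ mem T x
  mem-twoColumns₁ rewrite lookup-tabulate {V = twoColumns G S T} refl (combine x (Fin.suc Fin.zero))
                        | remQuot-combine {order G} {2} x (Fin.suc Fin.zero) = refl

module Columns (G : Graph) (n : ℕ) where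
  private
    m : ℕ
    m = order G
    H : Adj (m * n)
    H = prodAdj G n

  column : Subset (m * n) → Fin n → Subset m
  column C y = tabulate (λ x → mem C (combine x y))

  columns : Subset (m * n) → Vec (Subset m) n
  columns C = tabulate (column C)

  columnWord : Subset (m * n) → ℕ → Subset m
  columnWord C = lookupᵈ ∅ (columns C)

  mem-column : ∀ C y x → mem (column C y) x ≡ mem C (combine x y)
  mem-column C y x = lookup∘tabulate _ x

  columnWord-toℕ : ∀ C y → columnWord C (toℕ y) ≡ column C y
  columnWord-toℕ C y = trans (lookupᵈ-toℕ ∅ (columns C) y) (lookup∘tabulate (column C) y)

  columnWord-fromℕ< : ∀ C {c} (c<n : c < n) → columnWord C c ≡ column C (fromℕ< c<n)
  columnWord-fromℕ< C c<n = trans (cong (columnWord C) (sym (toℕ-fromℕ< c<n))) (columnWord-toℕ C (fromℕ< c<n))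

  columnWord-nonempty⁺ : ∀ C a → mem C a ≡ true → nonempty (columnWord C (col G n a)) ≡ true
  columnWord-nonempty⁺ C a a∈ with coordinates {m} {n} a
  ... | x , y , refl = subst (λ c → nonempty (columnWord C c) ≡ true) (sym (col-combine G n x y))
    (subst (λ S → nonempty S ≡ true) (sym (columnWord-toℕ C y)) (nonempty⁺ (column C y) x (trans (mem-column C y x) a∈)))

  columnWord-nonempty⁻ : ∀ C c → nonempty (columnWord C c) ≡ true → ∃ λ a → mem C a ≡ true × col G n a ≡ c
  columnWord-nonempty⁻ C c e with c ℕ.<? n
  ... | no  c≮n = contradiction
    (trans (sym e) (trans (cong nonempty (lookupᵈ-≥ ∅ (columns C) c (≮⇒≥ c≮n))) (nonempty-∅ {m}))) true≢false
  ... | yes c<n with nonempty⁻ (column C (fromℕ< c<n)) (subst (λ S → nonempty S ≡ true) (columnWord-fromℕ< C c<n) e)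
  ...   | x , x∈ = combine x (fromℕ< c<n) , trans (sym (mem-column C _ x)) x∈ ,
                   trans (col-combine G n x _) (toℕ-fromℕ< c<n)

  isConnectedSet-one-column : ∀ C c → c < n → (∀ a → mem C a ≡ true → col G n a ≡ c) →
                              isConnectedSet H C ≡ connected G (columnWord C c)
  isConnectedSet-one-column C c c<n inside =
    trans (sym (isConnectedSet-transport iso)) (cong (connected G) (sym (columnWord-fromℕ< C c<n)))
    where
    y : Fin n
    y = fromℕ< c<n
    horizontal : ∀ x x′ → H (combine x y) (combine x′ y) ≡ adj G x x′
    horizontal x x′ rewrite prodAdj-combine G n x x′ y y | ⌊⌋-true⁺ (y Fin.≟ y) refl | pathAdj-irrefl n y
      = trans (cong (_∨ _) (∧-identityʳ (adj G x x′)))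
              (trans (cong (adj G x x′ ∨_) (∧-zeroʳ ⌊ x Fin.≟ x′ ⌋)) (∨-identityʳ _))
    onto : ∀ b → mem C b ≡ true → ∃ λ x → combine x y ≡ b
    onto b b∈ with coordinates {m} {n} b
    ... | x , y′ , refl = x , cong (combine x) (toℕ-injective
            (trans (toℕ-fromℕ< c<n) (trans (sym (inside _ b∈)) (col-combine G n x y′))))
    iso : InducedIsomorphism H C (adj G) (column C y)
    iso = record
      { f           = λ x → combine x y
      ; f-injective = λ x x′ e → proj₁ (combine-injective x y x′ y e)
      ; mem-f       = λ x → sym (mem-column C y x)
      ; f-onto      = onto
      ; adj-f       = λ x x′ _ _ → horizontal x x′
      }

  mem-restrict2 : ∀ C c a →
    mem (restrict2 G n C c) a ≡ mem C a ∧ (⌊ col G n a ℕ.≟ c ⌋ ∨ ⌊ col G n a ℕ.≟ suc c ⌋)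
  mem-restrict2 C c a = lookup∘tabulate _ a

  restrict2-⊆ : ∀ C c a → mem (restrict2 G n C c) a ≡ true → mem C a ≡ true
  restrict2-⊆ C c a a∈ = ∧-conicalˡ (mem C a) _ (trans (sym (mem-restrict2 C c a)) a∈)

  restrict2⁺ : ∀ C c {a} → mem C a ≡ true → col G n a ≡ c ⊎ col G n a ≡ suc c → mem (restrict2 G n C c) a ≡ true
  restrict2⁺ C c {a} a∈ in-band = trans (mem-restrict2 C c a) (∧-true⁺ a∈ (band in-band))
    where
    band : col G n a ≡ c ⊎ col G n a ≡ suc c → (⌊ col G n a ℕ.≟ c ⌋ ∨ ⌊ col G n a ℕ.≟ suc c ⌋) ≡ true
    band (inj₁ eq) = ∨-trueˡ _ (⌊⌋-true⁺ (col G n a ℕ.≟ c) eq)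
    band (inj₂ eq) = ∨-trueʳ ⌊ col G n a ℕ.≟ c ⌋ (⌊⌋-true⁺ (col G n a ℕ.≟ suc c) eq)

  -- Columns c and c + 1 of G × P_n span a copy of G × P_2, through g : Fin 2 → Fin n.
  module TwoColumns (C : Subset (m * n)) (c : ℕ) (c+1<n : suc c < n) where

    c<n : c < n
    c<n = <-trans (n<1+n c) c+1<n

    g : Fin 2 → Fin n
    g Fin.zero    = fromℕ< c<n
    g (Fin.suc _) = fromℕ< c+1<n

    toℕ-g : ∀ e → toℕ (g e) ≡ toℕ e + c
    toℕ-g Fin.zero               = toℕ-fromℕ< c<n
    toℕ-g (Fin.suc Fin.zero)     = toℕ-fromℕ< c+1<n

    g-≟ : ∀ e e′ → ⌊ g e Fin.≟ g e′ ⌋ ≡ ⌊ e Fin.≟ e′ ⌋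
    g-≟ e e′ = bool-ext
      (λ t → ⌊⌋-true⁺ (e Fin.≟ e′) (toℕ-injective (+-cancelʳ-≡ c _ _ (trans (sym (toℕ-g e))
                 (trans (cong toℕ (⌊⌋-true⁻ (g e Fin.≟ g e′) t)) (toℕ-g e′))))))
      (λ t → ⌊⌋-true⁺ (g e Fin.≟ g e′) (cong g (⌊⌋-true⁻ (e Fin.≟ e′) t)))

    g-path : ∀ e e′ → pathAdj n (g e) (g e′) ≡ pathAdj 2 e e′
    g-path e e′ rewrite toℕ-g e | toℕ-g e′ =
      cong₂ _∨_ (shift (suc (toℕ e)) (toℕ e′)) (shift (suc (toℕ e′)) (toℕ e))
      where
      shift : ∀ i j → ⌊ i + c ℕ.≟ j + c ⌋ ≡ ⌊ i ℕ.≟ j ⌋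
      shift i j = bool-ext (λ t → ⌊⌋-true⁺ (i ℕ.≟ j) (+-cancelʳ-≡ c _ _ (⌊⌋-true⁻ (i + c ℕ.≟ j + c) t)))
                           (λ t → ⌊⌋-true⁺ (i + c ℕ.≟ j + c) (cong (_+ c) (⌊⌋-true⁻ (i ℕ.≟ j) t)))

    g-injective : ∀ e e′ → g e ≡ g e′ → e ≡ e′
    g-injective e e′ ge≡ge′ =
      ⌊⌋-true⁻ (e Fin.≟ e′) (trans (sym (g-≟ e e′)) (⌊⌋-true⁺ (g e Fin.≟ g e′) ge≡ge′))

    f : Fin (m * 2) → Fin (m * n)
    f a = combine (proj₁ (remQuot {m} 2 a)) (g (proj₂ (remQuot {m} 2 a)))

    f-combine : ∀ x e → f (combine x e) ≡ combine x (g e)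
    f-combine x e = cong (λ p → combine (proj₁ p) (g (proj₂ p))) (remQuot-combine {m} {2} x e)

    S T : Subset m
    S = column C (g Fin.zero)
    T = column C (g (Fin.suc Fin.zero))

    R : Subset (m * n)
    R = restrict2 G n C c

    mem-f : ∀ a → mem R (f a) ≡ mem (twoColumns G S T) a
    mem-f a with coordinates {m} {2} a
    ... | x , Fin.zero , refl
      rewrite f-combine x Fin.zero | mem-restrict2 C c (combine x (g Fin.zero)) | col-combine G n x (g Fin.zero)
            | toℕ-g Fin.zero | ⌊⌋-true⁺ (c ℕ.≟ c) refl | mem-twoColumns₀ G S T x | mem-column C (g Fin.zero) x
      = ∧-identityʳ _
    ... | x , Fin.suc Fin.zero , refl
      rewrite f-combine x (Fin.suc Fin.zero) | mem-restrict2 C c (combine x (g (Fin.suc Fin.zero)))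
            | col-combine G n x (g (Fin.suc Fin.zero)) | toℕ-g (Fin.suc Fin.zero)
            | ⌊⌋-true⁺ (suc c ℕ.≟ suc c) refl | mem-twoColumns₁ G S T x | mem-column C (g (Fin.suc Fin.zero)) x
      = trans (cong (mem C (combine x (g (Fin.suc Fin.zero))) ∧_) (∨-zeroʳ _)) (∧-identityʳ _)

    f-onto : ∀ b → mem R b ≡ true → ∃ λ a → f a ≡ b
    f-onto b b∈ with coordinates {m} {n} b
    ... | x , z , refl with ∨-true⁻ _ (∧-conicalʳ (mem C (combine x z)) _ (trans (sym (mem-restrict2 C c _)) b∈))
    ...   | inj₁ col≡c   = combine x Fin.zero , trans (f-combine x Fin.zero) (cong (combine x) (toℕ-injective
              (trans (toℕ-g Fin.zero) (trans (sym (⌊⌋-true⁻ (_ ℕ.≟ c) col≡c)) (col-combine G n x z)))))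
    ...   | inj₂ col≡c+1 = combine x (Fin.suc Fin.zero) , trans (f-combine x (Fin.suc Fin.zero))
              (cong (combine x) (toℕ-injective (trans (toℕ-g (Fin.suc Fin.zero))
                (trans (sym (⌊⌋-true⁻ (_ ℕ.≟ suc c) col≡c+1)) (col-combine G n x z)))))

    f-injective : ∀ a b → f a ≡ f b → a ≡ b
    f-injective a b fa≡fb with coordinates {m} {2} a | coordinates {m} {2} b
    ... | x , e , refl | x′ , e′ , refl
      with combine-injective x (g e) x′ (g e′) (trans (sym (f-combine x e)) (trans fa≡fb (f-combine x′ e′)))
    ...   | refl , ge≡ge′ = cong (combine x) (g-injective e e′ ge≡ge′)

    adj-f : ∀ a b → H (f a) (f b) ≡ prodAdj G 2 a b
    adj-f a b with coordinates {m} {2} a | coordinates {m} {2} b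
    ... | x , e , refl | x′ , e′ , refl rewrite f-combine x e | f-combine x′ e′ =
      trans (prodAdj-combine G n x x′ (g e) (g e′))
            (trans (cong₂ _∨_ (cong (adj G x x′ ∧_) (g-≟ e e′)) (cong (⌊ x Fin.≟ x′ ⌋ ∧_) (g-path e e′)))
                   (sym (prodAdj-combine G 2 x x′ e e′)))

    iso : InducedIsomorphism H R (prodAdj G 2) (twoColumns G S T)
    iso = record
      { f = f ; f-injective = f-injective ; mem-f = mem-f ; f-onto = f-onto ; adj-f = λ a b _ _ → adj-f a b }

  isConnectedSet-two-columns : ∀ C c → suc c < n →
    isConnectedSet H (restrict2 G n C c) ≡ linked G (columnWord C c) (columnWord C (suc c))
  isConnectedSet-two-columns C c c+1<n =
    trans (sym (isConnectedSet-transport iso))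
          (sym (cong₂ (linked G) (columnWord-fromℕ< C c<n) (columnWord-fromℕ< C c+1<n)))
    where open TwoColumns C c c+1<n

  fromColumns : Vec (Subset m) n → Subset (m * n)
  fromColumns L = tabulate (λ a → mem (lookup L (proj₂ (remQuot {m} n a))) (proj₁ (remQuot {m} n a)))

  mem-fromColumns : ∀ L x y → mem (fromColumns L) (combine x y) ≡ mem (lookup L y) x
  mem-fromColumns L x y = trans (lookup∘tabulate _ (combine x y))
    (cong (λ p → mem (lookup L (proj₂ p)) (proj₁ p)) (remQuot-combine {m} {n} x y))

  columns-↔ : Subset (m * n) ↔ Vec (Subset m) n
  columns-↔ = mk↔ₛ′ columns fromColumns columns∘fromColumns fromColumns∘columns
    where
    columns∘fromColumns : ∀ L → columns (fromColumns L) ≡ L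
    columns∘fromColumns L = trans (tabulate-cong (λ y → trans (tabulate-cong (λ x → mem-fromColumns L x y))
                                                              (tabulate∘lookup (lookup L y))))
                                  (tabulate∘lookup L)
    fromColumns∘columns : ∀ C → fromColumns (columns C) ≡ C
    fromColumns∘columns C = trans (tabulate-cong same) (tabulate∘lookup C)
      where
      same : ∀ a → mem (lookup (columns C) (proj₂ (remQuot {m} n a))) (proj₁ (remQuot {m} n a)) ≡ lookup C a
      same a with coordinates {m} {n} a
      ... | x , y , refl = begin
        mem (lookup (columns C) (proj₂ (remQuot {m} n (combine x y)))) (proj₁ (remQuot {m} n (combine x y)))
          ≡⟨ cong (λ p → mem (lookup (columns C) (proj₂ p)) (proj₁ p)) (remQuot-combine {m} {n} x y) ⟩
        mem (lookup (columns C) y) x   ≡⟨ cong (λ S → mem S x) (lookup∘tabulate (column C) y) ⟩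
        mem (column C y) x             ≡⟨ mem-column C y x ⟩
        mem C (combine x y)            ∎
        where open ≡-Reasoning

-- Column words: w c stands for column c of a subset of G × P_n (∅ beyond the last column),
-- and LWord w is membership in 𝒞_L (see isLConnectedSet≡isLWord).
module ColumnWords {X : Set} (nonempty : X → Bool) (connected : X → Bool) (linked : X → X → Bool)
                   (∅ : X) (nonempty-∅ : nonempty ∅ ≡ false) where

  Nonempty : X → Set
  Nonempty S = nonempty S ≡ true

  Blank : X → Set
  Blank S = nonempty S ≡ false

  nonempty≢blank : ∀ {S} → Nonempty S → ¬ Blank S
  nonempty≢blank S≠ S∅ = true≢false (trans (sym S≠) S∅)

  record Chain (w : ℕ → X) : Set where
    field
      convex : ∀ {a b c} → a ≤ b → b ≤ c → Nonempty (w a) → Nonempty (w c) → Nonempty (w b)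
      linked-suc : ∀ c → Nonempty (w c) → Nonempty (w (suc c)) → linked (w c) (w (suc c)) ≡ true

  record LWord (w : ℕ → X) : Set where
    field
      occupied  : ∃ λ c → Nonempty (w c)
      chain     : Chain w
      lone-connected : ∀ c → Nonempty (w c) → (∀ c′ → ¬ c′ ≡ c → Blank (w c′)) → connected (w c) ≡ true
    open Chain chain public

  Chain-single : ∀ w → (∀ c → Blank (w (suc c))) → Chain w
  Chain-single w blank = record { convex = convex ; linked-suc = λ c _ w₊ → contradiction (blank c) (nonempty≢blank w₊) }
    where
    convex : ∀ {a b c} → a ≤ b → b ≤ c → Nonempty (w a) → Nonempty (w c) → Nonempty (w b)
    convex {c = suc c} _   _   _  wc = contradiction (blank c) (nonempty≢blank wc)
    convex {zero} {zero} {zero} _ _ wa _ = wa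

  Chain-tail : ∀ w → Nonempty (w 0) → Chain w → Blank (w 1) → ∀ c → Blank (w (suc (suc c)))
  Chain-tail w w₀ ch w₁ c = ¬true⇒false (λ w₂ → nonempty≢blank (Chain.convex ch z≤n (s≤s z≤n) w₀ w₂) w₁)

  Chain-shift : ∀ w → Chain w → Chain (w ∘ suc)
  Chain-shift w ch = record
    { convex = λ p q → Chain.convex ch (s≤s p) (s≤s q) ; linked-suc = Chain.linked-suc ch ∘ suc }

  Chain-cons : ∀ w → Nonempty (w 0) → Nonempty (w 1) → linked (w 0) (w 1) ≡ true → Chain (w ∘ suc) → Chain w
  Chain-cons w w₀ w₁ link ch = record { convex = convex ; linked-suc = linked-suc }
    where
    convex : ∀ {a b c} → a ≤ b → b ≤ c → Nonempty (w a) → Nonempty (w c) → Nonempty (w b)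
    convex {zero}  {zero}          _       _       _  _  = w₀
    convex {zero}  {suc b} {suc c} _       (s≤s q) _  wc = Chain.convex ch z≤n q w₁ wc
    convex {suc a} {suc b} {suc c} (s≤s p) (s≤s q) wa wc = Chain.convex ch p q wa wc
    linked-suc : ∀ c → Nonempty (w c) → Nonempty (w (suc c)) → linked (w c) (w (suc c)) ≡ true
    linked-suc zero    _ _ = link
    linked-suc (suc c)     = Chain.linked-suc ch c

  Chain⇒LWord : ∀ w → Nonempty (w 0) → Nonempty (w 1) → Chain w → LWord w
  Chain⇒LWord w w₀ w₁ ch = record { occupied = 0 , w₀ ; chain = ch ; lone-connected = lone }
    where
    lone : ∀ c → Nonempty (w c) → (∀ c′ → ¬ c′ ≡ c → Blank (w c′)) → connected (w c) ≡ true
    lone zero    _ others = contradiction (others 1 (λ ())) (nonempty≢blank w₁)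
    lone (suc c) _ others = contradiction (others 0 (λ ())) (nonempty≢blank w₀)

  LWord-single : ∀ w → Nonempty (w 0) → (∀ c → Blank (w (suc c))) → LWord w ⇔ (connected (w 0) ≡ true)
  LWord-single w w₀ blank = mk⇔ to from
    where
    others : ∀ c′ → ¬ c′ ≡ 0 → Blank (w c′)
    others zero    0≢0 = contradiction refl 0≢0
    others (suc c) _   = blank c
    to : LWord w → connected (w 0) ≡ true
    to s = LWord.lone-connected s 0 w₀ others
    from : connected (w 0) ≡ true → LWord w
    from conn = record { occupied = 0 , w₀ ; chain = Chain-single w blank ; lone-connected = lone }
      where
      lone : ∀ c → Nonempty (w c) → (∀ c′ → ¬ c′ ≡ c → Blank (w c′)) → connected (w c) ≡ true
      lone zero    _  _ = conn
      lone (suc c) wc _ = contradiction (blank c) (nonempty≢blank wc)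

  LWord-shift : ∀ w → Blank (w 0) → LWord w ⇔ LWord (w ∘ suc)
  LWord-shift w w₀ = mk⇔ to from
    where
    to : LWord w → LWord (w ∘ suc)
    to s with LWord.occupied s
    ... | zero  , w₀≠ = contradiction w₀ (nonempty≢blank w₀≠)
    ... | suc c , wc  = record
      { occupied = c , wc ; chain = Chain-shift w (LWord.chain s)
      ; lone-connected = λ c wc others → LWord.lone-connected s (suc c) wc (lift others) }
      where
      lift : ∀ {c} → (∀ c′ → ¬ c′ ≡ c → Blank (w (suc c′))) → ∀ c′ → ¬ c′ ≡ suc c → Blank (w c′)
      lift _      zero     _ = w₀
      lift others (suc c′) ≢ = others c′ (≢ ∘ cong suc)
    from : LWord (w ∘ suc) → LWord w
    from s = record { occupied = suc c , wc ; chain = chain ; lone-connected = lone }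
      where
      c : ℕ
      c = proj₁ (LWord.occupied s)
      wc : Nonempty (w (suc c))
      wc = proj₂ (LWord.occupied s)
      chain : Chain w
      chain = record { convex = convex ; linked-suc = linked-suc }
        where
        convex : ∀ {a b c} → a ≤ b → b ≤ c → Nonempty (w a) → Nonempty (w c) → Nonempty (w b)
        convex {zero}                  _       _       wa _  = contradiction w₀ (nonempty≢blank wa)
        convex {suc a} {suc b} {suc c} (s≤s p) (s≤s q) wa wc = LWord.convex s p q wa wc
        linked-suc : ∀ c → Nonempty (w c) → Nonempty (w (suc c)) → linked (w c) (w (suc c)) ≡ true
        linked-suc zero    wa _ = contradiction w₀ (nonempty≢blank wa)
        linked-suc (suc c)      = LWord.linked-suc s c
      lone : ∀ c → Nonempty (w c) → (∀ c′ → ¬ c′ ≡ c → Blank (w c′)) → connected (w c) ≡ true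
      lone zero    wa _      = contradiction w₀ (nonempty≢blank wa)
      lone (suc c) wc others = LWord.lone-connected s c wc (λ c′ ≢ → others (suc c′) (≢ ∘ suc-injective))

  _‼_ : ∀ {n} → Vec X n → ℕ → X
  _‼_ = lookupᵈ ∅

  allBlank : ∀ {n} → Vec X n → Bool
  allBlank []      = true
  allBlank (U ∷ L) = not (nonempty U) ∧ allBlank L

  chainFrom : ∀ {n} → X → Vec X n → Bool
  chainFrom T []      = true
  chainFrom T (U ∷ L) = if nonempty U then linked T U ∧ chainFrom U L else allBlank L

  startingAt : ∀ {n} → X → Vec X n → Bool
  startingAt S []      = connected S
  startingAt S (T ∷ L) = if nonempty T then linked S T ∧ chainFrom T L else connected S ∧ allBlank L

  isLWord : ∀ {n} → Vec X n → Bool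
  isLWord []      = false
  isLWord (S ∷ L) = if nonempty S then startingAt S L else isLWord L

  allBlank⇔ : ∀ {n} (L : Vec X n) → (allBlank L ≡ true) ⇔ (∀ c → Blank (L ‼ c))
  allBlank⇔ []      = mk⇔ (λ _ _ → nonempty-∅) (λ _ → refl)
  allBlank⇔ (U ∷ L) = mk⇔ to from
    where
    to : allBlank (U ∷ L) ≡ true → ∀ c → Blank ((U ∷ L) ‼ c)
    to e zero with nonempty U
    ... | false = refl
    to e (suc c) = Equivalence.to (allBlank⇔ L) (∧-conicalʳ (not (nonempty U)) _ e) c
    from : (∀ c → Blank ((U ∷ L) ‼ c)) → allBlank (U ∷ L) ≡ true
    from blank rewrite blank 0 = Equivalence.from (allBlank⇔ L) (blank ∘ suc)

  private
    blank-after : ∀ {n U} (L : Vec X n) → Blank U → allBlank L ≡ true → ∀ c → Blank ((U ∷ L) ‼ c)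
    blank-after L U∅ _  zero    = U∅
    blank-after L _  L∅ (suc c) = Equivalence.to (allBlank⇔ L) L∅ c

  chainFrom⇔ : ∀ {n} T (L : Vec X n) → Nonempty T → (chainFrom T L ≡ true) ⇔ Chain ((T ∷ L) ‼_)
  chainFrom⇔ T []      _  = mk⇔ (λ _ → Chain-single ((T ∷ []) ‼_) (λ _ → nonempty-∅)) (λ _ → refl)
  chainFrom⇔ T (U ∷ L) T≠ with nonempty U in U?
  ... | true  = mk⇔
    (λ e → Chain-cons w T≠ U? (∧-conicalˡ (linked T U) _ e)
                               (Equivalence.to (chainFrom⇔ U L U?) (∧-conicalʳ (linked T U) _ e)))
    (λ ch → ∧-true⁺ (Chain.linked-suc ch 0 T≠ U?) (Equivalence.from (chainFrom⇔ U L U?) (Chain-shift w ch)))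
    where
    w : ℕ → X
    w = (T ∷ U ∷ L) ‼_
  ... | false = mk⇔
    (λ e → Chain-single w (blank-after L U? e))
    (λ ch → Equivalence.from (allBlank⇔ L) (Chain-tail w T≠ ch U?))
    where
    w : ℕ → X
    w = (T ∷ U ∷ L) ‼_

  startingAt⇔ : ∀ {n} S (L : Vec X n) → Nonempty S → (startingAt S L ≡ true) ⇔ LWord ((S ∷ L) ‼_)
  startingAt⇔ S []      S≠ = ⇔-sym (LWord-single ((S ∷ []) ‼_) S≠ (λ _ → nonempty-∅))
  startingAt⇔ S (T ∷ L) S≠ with nonempty T in T?
  ... | true  = mk⇔
    (λ e → Chain⇒LWord w S≠ T? (Chain-cons w S≠ T? (∧-conicalˡ (linked S T) _ e)
                                  (Equivalence.to (chainFrom⇔ T L T?) (∧-conicalʳ (linked S T) _ e))))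
    (λ s → ∧-true⁺ (LWord.linked-suc s 0 S≠ T?) (Equivalence.from (chainFrom⇔ T L T?) (Chain-shift w (LWord.chain s))))
    where
    w : ℕ → X
    w = (S ∷ T ∷ L) ‼_
  ... | false = mk⇔
    (λ e → Equivalence.from (single (∧-conicalʳ (connected S) _ e)) (∧-conicalˡ (connected S) _ e))
    (λ s → let L∅ = Equivalence.from (allBlank⇔ L) (Chain-tail w S≠ (LWord.chain s) T?)
           in ∧-true⁺ (Equivalence.to (single L∅) s) L∅)
    where
    w : ℕ → X
    w = (S ∷ T ∷ L) ‼_
    single : allBlank L ≡ true → LWord w ⇔ (connected S ≡ true)
    single L∅ = LWord-single w S≠ (blank-after L T? L∅)

  isLWord⇔ : ∀ {n} (L : Vec X n) → (isLWord L ≡ true) ⇔ LWord (L ‼_)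
  isLWord⇔ []      = mk⇔ (λ ()) (λ s → contradiction nonempty-∅ (nonempty≢blank (proj₂ (LWord.occupied s))))
  isLWord⇔ (S ∷ L) with nonempty S in S?
  ... | true  = startingAt⇔ S L S?
  ... | false = ⇔-trans (isLWord⇔ L) (⇔-sym (LWord-shift ((S ∷ L) ‼_) S?))

blank⇒≡∅ : ∀ {k} (S : Subset k) → nonempty S ≡ false → S ≡ ∅
blank⇒≡∅ S blank = pointwise S (λ x → ¬true⇒false (λ x∈ → true≢false (trans (sym (nonempty⁺ S x x∈)) blank)))
  where
  pointwise : ∀ {k} (S : Subset k) → (∀ x → mem S x ≡ false) → S ≡ ∅
  pointwise []      _   = refl
  pointwise (b ∷ S) out = cong₂ _∷_ (out Fin.zero) (pointwise S (out ∘ Fin.suc))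


module Words (G : Graph) = ColumnWords nonempty (connected G) (linked G) ∅ (nonempty-∅ {order G})

module LConnected (G : Graph) (n : ℕ) where
  open Columns G n
  open Words G
  private
    m : ℕ
    m = order G
    H : Adj (m * n)
    H = prodAdj G n

  col<n : ∀ a → col G n a < n
  col<n a = toℕ<n (proj₂ (Fin.remQuot {m} n a))

  meets≡nonempty : ∀ C c → meets G n C c ≡ nonempty (columnWord C c)
  meets≡nonempty C c = bool-ext to from
    where
    to : meets G n C c ≡ true → nonempty (columnWord C c) ≡ true
    to e with any-true⁻ _ (allFin (m * n)) e
    ... | a , _ , q = subst (λ c → nonempty (columnWord C c) ≡ true)
                            (⌊⌋-true⁻ (col G n a ℕ.≟ c) (∧-conicalʳ (mem C a) _ q))
                            (columnWord-nonempty⁺ C a (∧-conicalˡ (mem C a) _ q))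
    from : nonempty (columnWord C c) ≡ true → meets G n C c ≡ true
    from e with columnWord-nonempty⁻ C c e
    ... | a , a∈ , col≡c = any-true⁺ _ (∈-allFin a) (∧-true⁺ a∈ (⌊⌋-true⁺ (col G n a ℕ.≟ c) col≡c))

  module _ (C : Subset (m * n)) where
    private
      W : ℕ → Subset m
      W = columnWord C

    isConnectedSet-lone-column : ∀ c → Nonempty (W c) → (∀ c′ → ¬ c′ ≡ c → Blank (W c′)) →
                                 isConnectedSet H C ≡ connected G (W c)
    isConnectedSet-lone-column c Wc others with columnWord-nonempty⁻ C c Wc
    ... | a , _ , refl = isConnectedSet-one-column C (col G n a) (col<n a) inside
      where
      inside : ∀ b → mem C b ≡ true → col G n b ≡ col G n a
      inside b b∈ with col G n b ℕ.≟ col G n a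
      ... | yes eq = eq
      ... | no  ≢  = contradiction (others _ ≢) (nonempty≢blank {W (col G n b)} (columnWord-nonempty⁺ C b b∈))

    isLConnectedSet⇒LWord : isLConnectedSet G n C ≡ true → LWord W
    isLConnectedSet⇒LWord e = record
      { occupied       = col G n a₀ , columnWord-nonempty⁺ C a₀ a₀∈
      ; chain          = record { convex = convex ; linked-suc = linked-suc }
      ; lone-connected = λ c Wc others → trans (sym (isConnectedSet-lone-column c Wc others)) C-connected
      }
      where
      C-connected : isConnectedSet H C ≡ true
      C-connected = ∧-conicalˡ (isConnectedSet H C) _ e
      pairs-connected : all (λ c → not (meets G n C c ∧ meets G n C (suc c)) ∨ isConnectedSet H (restrict2 G n C c))
                            (upTo n) ≡ true
      pairs-connected = ∧-conicalʳ (isConnectedSet H C) _ e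
      a₀ : Fin (m * n)
      a₀ = proj₁ (proj₁ (isConnectedSet⇒ConnectedSet H C C-connected))
      a₀∈ : mem C a₀ ≡ true
      a₀∈ = proj₂ (proj₁ (isConnectedSet⇒ConnectedSet H C C-connected))
      convex : ∀ {a b c} → a ≤ b → b ≤ c → Nonempty (W a) → Nonempty (W c) → Nonempty (W b)
      convex {a} {b} {c} p q Wa Wc with columnWord-nonempty⁻ C a Wa | columnWord-nonempty⁻ C c Wc
      ... | x , x∈ , refl | z , z∈ , refl
        with Walk-visits-columns G n (proj₂ (isConnectedSet⇒ConnectedSet H C C-connected) x z x∈ z∈) x∈ b p q
      ...   | y , y∈ , refl = columnWord-nonempty⁺ C y y∈
      linked-suc : ∀ c → Nonempty (W c) → Nonempty (W (suc c)) → linked G (W c) (W (suc c)) ≡ true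
      linked-suc c Wc Wc₊ with columnWord-nonempty⁻ C (suc c) Wc₊
      ... | b , _ , b-col = trans (sym (isConnectedSet-two-columns C c c+1<n))
        (implies⁻ (all-true⁻ _ pairs-connected (∈-upTo⁺ (≤-<-trans (n≤1+n c) c+1<n)))
                  (trans (meets≡nonempty C c) Wc) (trans (meets≡nonempty C (suc c)) Wc₊))
        where
        c+1<n : suc c < n
        c+1<n = subst (_< n) b-col (col<n b)

    module WalksInLWord (s : LWord W) where
      open LWord s

      restrict2-connected : ∀ c → Nonempty (W c) → Nonempty (W (suc c)) →
                            isConnectedSet H (restrict2 G n C c) ≡ true
      restrict2-connected c Wc Wc₊ with columnWord-nonempty⁻ C (suc c) Wc₊
      ... | b , _ , b-col = trans (isConnectedSet-two-columns C c (subst (_< n) b-col (col<n b))) (linked-suc c Wc Wc₊)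

      walk-two-columns : ∀ c {a b} → Nonempty (W c) → Nonempty (W (suc c)) → mem C a ≡ true → mem C b ≡ true →
                         col G n a ≡ c ⊎ col G n a ≡ suc c → col G n b ≡ c ⊎ col G n b ≡ suc c → Walk H C a b
      walk-two-columns c Wc Wc₊ a∈ b∈ a-band b-band =
        Walk-⊆ (restrict2-⊆ C c)
          (proj₂ (isConnectedSet⇒ConnectedSet H _ (restrict2-connected c Wc Wc₊)) _ _
                 (restrict2⁺ C c a∈ a-band) (restrict2⁺ C c b∈ b-band))

      -- By convexity, a column with blank neighbours is the only non-blank one.
      isolated : ∀ c → Nonempty (W c) → Blank (W (suc c)) → (∀ p → suc p ≡ c → Blank (W p)) →
                 ∀ c′ → ¬ c′ ≡ c → Blank (W c′)
      isolated c Wc up down c′ c′≢c with nonempty (W c′) in Wc′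
      ... | false = refl
      ... | true with <-cmp c′ c
      ...   | tri≈ _ c′≡c _ = contradiction c′≡c c′≢c
      ...   | tri> _ _ c<c′ = contradiction up (nonempty≢blank {W (suc c)} (convex (n≤1+n c) c<c′ Wc Wc′))
      isolated (suc p) Wc up down c′ _ | true | tri< c′<c _ _ =
        contradiction (down p refl) (nonempty≢blank {W p} (convex (≤-pred c′<c) (n≤1+n p) Wc′ Wc))

      neighbour-below : ∀ c → (∃ λ p → suc p ≡ c × Nonempty (W p)) ⊎ (∀ p → suc p ≡ c → Blank (W p))
      neighbour-below zero    = inj₂ (λ _ ())
      neighbour-below (suc p) with nonempty (W p) in Wp
      ... | true  = inj₁ (p , refl , Wp)
      ... | false = inj₂ blank
        where
        blank : ∀ q → suc q ≡ suc p → Blank (W q)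
        blank _ refl = Wp

      walk-in-column : ∀ c {a b} → Nonempty (W c) → mem C a ≡ true → mem C b ≡ true →
                       col G n a ≡ c → col G n b ≡ c → Walk H C a b
      walk-in-column c Wc a∈ b∈ a-col b-col with nonempty (W (suc c)) in up | neighbour-below c
      ... | true  | _                    = walk-two-columns c Wc up a∈ b∈ (inj₁ a-col) (inj₁ b-col)
      ... | false | inj₁ (p , refl , Wp) = walk-two-columns p Wp Wc a∈ b∈ (inj₂ a-col) (inj₂ b-col)
      ... | false | inj₂ down            = proj₂ (isConnectedSet⇒ConnectedSet H C C-connected) _ _ a∈ b∈
        where
        others : ∀ c′ → ¬ c′ ≡ c → Blank (W c′)
        others = isolated c Wc up down
        C-connected : isConnectedSet H C ≡ true
        C-connected = trans (isConnectedSet-lone-column c Wc others) (lone-connected c Wc others)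

      walk-up : ∀ k {a b} → mem C a ≡ true → mem C b ≡ true → col G n b ≡ k + col G n a → Walk H C a b
      walk-up zero    {a}     a∈ b∈ b-col = walk-in-column (col G n a) (columnWord-nonempty⁺ C a a∈) a∈ b∈ refl b-col
      walk-up (suc k) {a} {b} a∈ b∈ b-col with columnWord-nonempty⁻ C (k + col G n a) Wk
        where
        Wb : Nonempty (W (suc k + col G n a))
        Wb = subst (Nonempty ∘ W) b-col (columnWord-nonempty⁺ C b b∈)
        Wk : Nonempty (W (k + col G n a))
        Wk = convex (m≤n+m _ k) (n≤1+n _) (columnWord-nonempty⁺ C a a∈) Wb
      ... | z , z∈ , z-col =
        walk-up k a∈ z∈ z-col ++ʷ walk-two-columns (k + col G n a) Wz Wb z∈ b∈ (inj₁ z-col) (inj₂ b-col)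
        where
        Wz : Nonempty (W (k + col G n a))
        Wz = subst (Nonempty ∘ W) z-col (columnWord-nonempty⁺ C z z∈)
        Wb : Nonempty (W (suc k + col G n a))
        Wb = subst (Nonempty ∘ W) b-col (columnWord-nonempty⁺ C b b∈)

      walk : ∀ a b → mem C a ≡ true → mem C b ≡ true → Walk H C a b
      walk a b a∈ b∈ with ≤-total (col G n a) (col G n b)
      ... | inj₁ a≤b = walk-up (col G n b ∸ col G n a) a∈ b∈ (sym (m∸n+n≡m a≤b))
      ... | inj₂ b≤a = reverseʷ (prodAdj-sym G n) b∈ (walk-up (col G n a ∸ col G n b) b∈ a∈ (sym (m∸n+n≡m b≤a)))

    LWord⇒isLConnectedSet : LWord W → isLConnectedSet G n C ≡ true
    LWord⇒isLConnectedSet s =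
      ∧-true⁺ (ConnectedSet⇒isConnectedSet H C (occupant , walk)) (all-true⁺ _ (upTo n) pair-connected)
      where
      open LWord s
      open WalksInLWord s
      occupant : ∃ λ a → mem C a ≡ true
      occupant with columnWord-nonempty⁻ C (proj₁ occupied) (proj₂ occupied)
      ... | a , a∈ , _ = a , a∈
      pair-connected : ∀ c → c ∈ upTo n →
        (not (meets G n C c ∧ meets G n C (suc c)) ∨ isConnectedSet H (restrict2 G n C c)) ≡ true
      pair-connected c _ = implies⁺ _ _ _ λ m₁ m₂ →
        restrict2-connected c (trans (sym (meets≡nonempty C c)) m₁) (trans (sym (meets≡nonempty C (suc c))) m₂)

  isLConnectedSet≡isLWord : ∀ C → isLConnectedSet G n C ≡ isLWord (columns C)
  isLConnectedSet≡isLWord C = bool-ext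
    (Equivalence.from (isLWord⇔ (columns C)) ∘ isLConnectedSet⇒LWord C)
    (LWord⇒isLConnectedSet C ∘ Equivalence.to (isLWord⇔ (columns C)))

-- Counting column words

module _ (O : ℕ → ℕ) where
  private
    fromTwo : ℕ → List ℕ
    fromTwo n = drop 2 (upTo (suc n))

    fromTwo-∷ʳ : ∀ n → fromTwo (suc (suc n)) ≡ fromTwo (suc n) ++ suc (suc n) ∷ []
    fromTwo-∷ʳ n = cong (drop 2) (sym (upTo-∷ʳ (suc (suc n))))

    ∑-fromTwo : ∀ n → ∑ (fromTwo (suc n)) (λ k → O (k ∸ 1)) ≡ ∑ (upTo n) (O ∘ suc)
    ∑-fromTwo zero    = refl
    ∑-fromTwo (suc n) = begin
      ∑ (fromTwo (suc (suc n))) (λ k → O (k ∸ 1))          ≡⟨ cong (λ l → ∑ l (λ k → O (k ∸ 1))) (fromTwo-∷ʳ n) ⟩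
      ∑ (fromTwo (suc n) ++ suc (suc n) ∷ []) (λ k → O (k ∸ 1)) ≡⟨ ∑-++ (fromTwo (suc n)) _ (λ k → O (k ∸ 1)) ⟩
      ∑ (fromTwo (suc n)) (λ k → O (k ∸ 1)) + (O (suc n) + 0) ≡⟨ cong₂ _+_ (∑-fromTwo n) (+-identityʳ _) ⟩
      ∑ (upTo n) (O ∘ suc) + O (suc n)                        ≡⟨ sym (∑-upTo-∷ʳ n (O ∘ suc)) ⟩
      ∑ (upTo (suc n)) (O ∘ suc)                              ∎
      where open ≡-Reasoning

  sumFromTo-weighted : ∀ n →
    sumFromTo 2 n (λ k → (n ∸ k + 1) * O (k ∸ 1)) ≡ ∑ (upTo n) (λ t → ∑ (upTo t) (O ∘ suc))
  sumFromTo-weighted zero          = refl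
  sumFromTo-weighted (suc zero)    = refl
  sumFromTo-weighted (suc (suc n)) = begin
    ∑ (fromTwo (suc (suc n))) (weight (suc (suc n)))
      ≡⟨ cong (λ l → ∑ l (weight (suc (suc n)))) (fromTwo-∷ʳ n) ⟩
    ∑ (fromTwo (suc n) ++ suc (suc n) ∷ []) (weight (suc (suc n)))
      ≡⟨ ∑-++ (fromTwo (suc n)) _ (weight (suc (suc n))) ⟩
    ∑ (fromTwo (suc n)) (weight (suc (suc n))) + (weight (suc (suc n)) (suc (suc n)) + 0)
      ≡⟨ cong₂ _+_ (∑-cong-∈ (fromTwo (suc n)) one-more) (trans (+-identityʳ _) last) ⟩
    ∑ (fromTwo (suc n)) (λ k → weight (suc n) k + O (k ∸ 1)) + O (suc n)
      ≡⟨ cong (_+ O (suc n)) (trans (∑-+ (fromTwo (suc n)) (weight (suc n)) (λ k → O (k ∸ 1)))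
                                    (cong₂ _+_ (sumFromTo-weighted (suc n)) (∑-fromTwo n))) ⟩
    ∑ (upTo (suc n)) A + ∑ (upTo n) (O ∘ suc) + O (suc n)
      ≡⟨ trans (+-assoc (∑ (upTo (suc n)) A) (∑ (upTo n) (O ∘ suc)) (O (suc n)))
               (cong (∑ (upTo (suc n)) A +_) (sym (∑-upTo-∷ʳ n (O ∘ suc)))) ⟩
    ∑ (upTo (suc n)) A + A (suc n)
      ≡⟨ sym (∑-upTo-∷ʳ (suc n) A) ⟩
    ∑ (upTo (suc (suc n))) A ∎
    where
    open ≡-Reasoning
    weight : ℕ → ℕ → ℕ
    weight n k = (n ∸ k + 1) * O (k ∸ 1)
    A : ℕ → ℕ
    A t = ∑ (upTo t) (O ∘ suc)
    last : weight (suc (suc n)) (suc (suc n)) ≡ O (suc n)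
    last rewrite n∸n≡0 n = +-identityʳ (O (suc n))
    one-more : ∀ k → k ∈ fromTwo (suc n) → weight (suc (suc n)) k ≡ weight (suc n) k + O (k ∸ 1)
    one-more k k∈ = begin
      (suc (suc n) ∸ k + 1) * O (k ∸ 1)        ≡⟨ cong (λ d → (d + 1) * O (k ∸ 1)) (+-∸-assoc 1 k≤) ⟩
      (suc (suc n ∸ k) + 1) * O (k ∸ 1)        ≡⟨⟩
      (1 + (suc n ∸ k + 1)) * O (k ∸ 1)        ≡⟨ *-distribʳ-+ (O (k ∸ 1)) 1 (suc n ∸ k + 1) ⟩
      1 * O (k ∸ 1) + weight (suc n) k          ≡⟨ +-comm (1 * O (k ∸ 1)) _ ⟩
      weight (suc n) k + 1 * O (k ∸ 1)          ≡⟨ cong (weight (suc n) k +_) (*-identityˡ _) ⟩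
      weight (suc n) k + O (k ∸ 1)              ∎
      where
      k≤ : k ≤ suc n
      k≤ = ≤-pred (∈-upTo⁻ (∈-drop⁻ 2 (upTo (suc (suc n))) k∈))

module CountingLWords (G : Graph) where
  open Words G
  private
    m : ℕ
    m = order G
    U : List (Subset m)
    U = allSubsets m
    V : ∀ n → List (Vec (Subset m) n)
    V = allVecs _≟ₛ_ U
    module Mₛ = Multiplicity (_≟ₛ_ {m})

  ∑⁺ : (Subset m → ℕ) → ℕ
  ∑⁺ f = ∑ U (λ S → 𝟙 (nonempty S) * f S)

  -- Walks from S in the graph on non-empty subsets whose adjacency matrix is A (see matA).
  walks : ℕ → Subset m → ℕ
  walks zero    _ = 1
  walks (suc j) S = ∑⁺ (λ T → 𝟙 (linked G S T) * walks j T)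

  totalWalks : ℕ → ℕ
  totalWalks j = ∑⁺ (walks j)

  #words : ∀ n → (Vec (Subset m) n → Bool) → ℕ
  #words n P = ∑ (V n) (𝟙 ∘ P)

  ∑-blank : ∑ U (λ S → 𝟙 (not (nonempty S))) ≡ 1
  ∑-blank = trans (∑-cong U indicator) (allSubsets-enumerates m ∅)
    where
    indicator : ∀ S → 𝟙 (not (nonempty S)) ≡ Mₛ.δ S ∅
    indicator S with nonempty S in e
    ... | false rewrite blank⇒≡∅ S e = sym (Mₛ.δ-refl ∅)
    ... | true  = sym (Mₛ.δ-≢ (λ S≡∅ → true≢false (trans (sym e) (trans (cong nonempty S≡∅) (nonempty-∅ {m})))))

  ∑-nonempty-or-blank : ∀ (X : Subset m → ℕ) c →
    ∑ U (λ S → 𝟙 (nonempty S) * X S + 𝟙 (not (nonempty S)) * c) ≡ ∑⁺ X + c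
  ∑-nonempty-or-blank X c = trans (∑-+ U _ _) (cong (∑⁺ X +_)
    (trans (∑-*ʳ U c (λ S → 𝟙 (not (nonempty S)))) (trans (cong (_* c) ∑-blank) (*-identityˡ c))))

  #words-if : ∀ n b (P Q : Vec (Subset m) n → Bool) →
              #words n (λ L → if b then P L else Q L) ≡ 𝟙 b * #words n P + 𝟙 (not b) * #words n Q
  #words-if n b P Q = trans (∑-cong (V n) (λ L → 𝟙-if b (P L) (Q L)))
    (trans (∑-+ (V n) _ _) (cong₂ _+_ (∑-*ˡ (V n) (𝟙 b) (𝟙 ∘ P)) (∑-*ˡ (V n) (𝟙 (not b)) (𝟙 ∘ Q))))

  #words-∧ : ∀ n a (P : Vec (Subset m) n → Bool) → #words n (λ L → a ∧ P L) ≡ 𝟙 a * #words n P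
  #words-∧ n a P = trans (∑-cong (V n) (λ L → 𝟙-∧ a (P L))) (∑-*ˡ (V n) (𝟙 a) (𝟙 ∘ P))

  #words-suc : ∀ n (P : Vec (Subset m) (suc n) → Bool) → #words (suc n) P ≡ ∑ U (λ S → #words n (P ∘ (S ∷_)))
  #words-suc n P = ∑-allVecs-suc _≟ₛ_ U n (𝟙 ∘ P)

  #allBlank : ∀ n → #words n allBlank ≡ 1
  #allBlank zero    = refl
  #allBlank (suc n) = begin
    #words (suc n) allBlank                               ≡⟨ #words-suc n allBlank ⟩
    ∑ U (λ S → #words n (λ L → not (nonempty S) ∧ allBlank L)) ≡⟨ ∑-cong U (λ S → #words-∧ n (not (nonempty S)) allBlank) ⟩
    ∑ U (λ S → 𝟙 (not (nonempty S)) * #words n allBlank)  ≡⟨ ∑-*ʳ U _ (λ S → 𝟙 (not (nonempty S))) ⟩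
    ∑ U (λ S → 𝟙 (not (nonempty S))) * #words n allBlank  ≡⟨ cong₂ _*_ ∑-blank (#allBlank n) ⟩
    1                                                     ∎
    where open ≡-Reasoning

  ∑⁺-∑ : ∀ js (g : ℕ → Subset m → ℕ) → ∑⁺ (λ S → ∑ js (λ j → g j S)) ≡ ∑ js (λ j → ∑⁺ (g j))
  ∑⁺-∑ js g = trans (∑-cong U (λ S → sym (∑-*ˡ js (𝟙 (nonempty S)) (λ j → g j S))))
                    (∑-comm U js (λ S j → 𝟙 (nonempty S) * g j S))

  #words-branch : ∀ n (X : Subset m → ℕ) c (P Q : Subset m → Vec (Subset m) n → Bool) →
    (∀ S → #words n (P S) ≡ X S) → (∀ S → #words n (Q S) ≡ c) →
    ∑ U (λ S → #words n (λ L → if nonempty S then P S L else Q S L)) ≡ ∑⁺ X + c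
  #words-branch n X c P Q #P #Q = trans
    (∑-cong U λ S → trans (#words-if n (nonempty S) (P S) (Q S))
                          (cong₂ (λ a b → 𝟙 (nonempty S) * a + 𝟙 (not (nonempty S)) * b) (#P S) (#Q S)))
    (∑-nonempty-or-blank X c)

  ∑⁺-linked-walks : ∀ js T →
    ∑⁺ (λ S → 𝟙 (linked G T S) * ∑ js (λ j → walks j S)) ≡ ∑ js (λ j → walks (suc j) T)
  ∑⁺-linked-walks js T = trans
    (∑-cong U (λ S → cong (𝟙 (nonempty S) *_) (sym (∑-*ˡ js (𝟙 (linked G T S)) (λ j → walks j S)))))
    (∑⁺-∑ js (λ j S → 𝟙 (linked G T S) * walks j S))

  #chainFrom : ∀ n T → #words n (chainFrom T) ≡ ∑ (upTo (suc n)) (λ j → walks j T)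
  #chainFrom zero    T = refl
  #chainFrom (suc n) T = begin
    #words (suc n) (chainFrom T)
      ≡⟨ #words-suc n (chainFrom T) ⟩
    ∑ U (λ S → #words n (λ L → if nonempty S then linked G T S ∧ chainFrom S L else allBlank L))
      ≡⟨ #words-branch n (λ S → 𝟙 (linked G T S) * ∑ (upTo (suc n)) (λ j → walks j S)) 1 _ _
           (λ S → trans (#words-∧ n (linked G T S) (chainFrom S)) (cong (𝟙 (linked G T S) *_) (#chainFrom n S)))
           (λ _ → #allBlank n) ⟩
    ∑⁺ (λ S → 𝟙 (linked G T S) * ∑ (upTo (suc n)) (λ j → walks j S)) + 1
      ≡⟨ cong (_+ 1) (∑⁺-linked-walks (upTo (suc n)) T) ⟩
    ∑ (upTo (suc n)) (λ j → walks (suc j) T) + 1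
      ≡⟨ trans (+-comm _ 1) (sym (∑-upTo-suc (suc n) (λ j → walks j T))) ⟩
    ∑ (upTo (suc (suc n))) (λ j → walks j T) ∎
    where open ≡-Reasoning

  #startingAt : ∀ t S → #words t (startingAt S) ≡ 𝟙 (connected G S) + ∑ (upTo t) (λ j → walks (suc j) S)
  #startingAt zero    S = refl
  #startingAt (suc t) S = begin
    #words (suc t) (startingAt S)
      ≡⟨ #words-suc t (startingAt S) ⟩
    ∑ U (λ T → #words t (λ L → if nonempty T then linked G S T ∧ chainFrom T L else connected G S ∧ allBlank L))
      ≡⟨ #words-branch t (λ T → 𝟙 (linked G S T) * ∑ (upTo (suc t)) (λ j → walks j T)) (𝟙 (connected G S)) _ _
           (λ T → trans (#words-∧ t (linked G S T) (chainFrom T)) (cong (𝟙 (linked G S T) *_) (#chainFrom t T)))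
           (λ _ → trans (#words-∧ t (connected G S) allBlank)
                        (trans (cong (𝟙 (connected G S) *_) (#allBlank t)) (*-identityʳ _))) ⟩
    ∑⁺ (λ T → 𝟙 (linked G S T) * ∑ (upTo (suc t)) (λ j → walks j T)) + 𝟙 (connected G S)
      ≡⟨ cong (_+ 𝟙 (connected G S)) (∑⁺-linked-walks (upTo (suc t)) S) ⟩
    ∑ (upTo (suc t)) (λ j → walks (suc j) S) + 𝟙 (connected G S)
      ≡⟨ +-comm (∑ (upTo (suc t)) (λ j → walks (suc j) S)) _ ⟩
    𝟙 (connected G S) + ∑ (upTo (suc t)) (λ j → walks (suc j) S) ∎
    where open ≡-Reasoning

  walksUpTo : ℕ → ℕ
  walksUpTo t = ∑ (upTo t) (λ j → totalWalks (suc j))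

  ∑⁺-#startingAt : ∀ t → ∑⁺ (λ S → #words t (startingAt S)) ≡ ∑⁺ (𝟙 ∘ connected G) + walksUpTo t
  ∑⁺-#startingAt t = begin
    ∑⁺ (λ S → #words t (startingAt S))
      ≡⟨ ∑-cong U (λ S → trans (cong (𝟙 (nonempty S) *_) (#startingAt t S)) (*-distribˡ-+ (𝟙 (nonempty S)) _ _)) ⟩
    ∑ U (λ S → 𝟙 (nonempty S) * 𝟙 (connected G S) + 𝟙 (nonempty S) * ∑ (upTo t) (λ j → walks (suc j) S))
      ≡⟨ ∑-+ U _ _ ⟩
    ∑⁺ (𝟙 ∘ connected G) + ∑⁺ (λ S → ∑ (upTo t) (λ j → walks (suc j) S))
      ≡⟨ cong (∑⁺ (𝟙 ∘ connected G) +_) (∑⁺-∑ (upTo t) (walks ∘ suc)) ⟩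
    ∑⁺ (𝟙 ∘ connected G) + walksUpTo t ∎
    where open ≡-Reasoning

  #isLWord : ∀ n → #words n isLWord ≡ n * ∑⁺ (𝟙 ∘ connected G) + ∑ (upTo n) walksUpTo
  #isLWord zero    = refl
  #isLWord (suc n) = begin
    #words (suc n) isLWord
      ≡⟨ #words-suc n isLWord ⟩
    ∑ U (λ S → #words n (λ L → if nonempty S then startingAt S L else isLWord L))
      ≡⟨ #words-branch n (λ S → #words n (startingAt S)) (#words n isLWord) _ _ (λ _ → refl) (λ _ → refl) ⟩
    ∑⁺ (λ S → #words n (startingAt S)) + #words n isLWord
      ≡⟨ cong₂ _+_ (∑⁺-#startingAt n) (#isLWord n) ⟩
    (N′ + walksUpTo n) + (n * N′ + ∑ (upTo n) walksUpTo)
      ≡⟨ trans (+-interchange N′ (walksUpTo n) (n * N′) _) (cong (N′ + n * N′ +_) (+-comm (walksUpTo n) _)) ⟩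
    (N′ + n * N′) + (∑ (upTo n) walksUpTo + walksUpTo n)
      ≡⟨ cong (N′ + n * N′ +_) (sym (∑-upTo-∷ʳ n walksUpTo)) ⟩
    suc n * N′ + ∑ (upTo (suc n)) walksUpTo ∎
    where
    open ≡-Reasoning
    N′ : ℕ
    N′ = ∑⁺ (𝟙 ∘ connected G)

  ∑⁺-connected : ∑⁺ (𝟙 ∘ connected G) ≡ N G
  ∑⁺-connected = trans (∑-cong U (λ S → connected⇒nonempty (nonempty S) _)) (sym (count≡∑ (isConnectedSet (adj G))))
    where
    -- isConnectedSet starts by checking non-emptiness.
    connected⇒nonempty : ∀ a r → 𝟙 a * 𝟙 (a ∧ r) ≡ 𝟙 (a ∧ r)
    connected⇒nonempty true  r = +-identityʳ _
    connected⇒nonempty false r = refl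

module AdjacencyMatrix (G : Graph) {d : ℕ} (φ : Fin d → Subset (order G)) (φ-enum : IsEnumeration φ) where
  open CountingLWords G
  private
    module Mₛ = Multiplicity (_≟ₛ_ {order G})
    module M  = Multiplicity (Fin._≟_ {d})
    A : Mat d
    A = matA G φ

  multiplicity-φ : ∀ S → Mₛ.multiplicity S (map φ (allFin d)) ≡ 𝟙 (nonempty S)
  multiplicity-φ S = trans (∑-map φ (allFin d) (λ T → Mₛ.δ T S)) (preimages S)
    where
    nonempty-φ : ∀ i → nonempty (φ i) ≡ true
    nonempty-φ = proj₁ φ-enum
    φ-injective : ∀ i j → φ i ≡ φ j → i ≡ j
    φ-injective = proj₁ (proj₂ φ-enum)
    φ-surjective : ∀ S → nonempty S ≡ true → ∃ λ i → φ i ≡ S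
    φ-surjective = proj₂ (proj₂ φ-enum)
    preimages : ∀ S → ∑ (allFin d) (λ i → Mₛ.δ (φ i) S) ≡ 𝟙 (nonempty S)
    preimages S with nonempty S in S≠
    ... | true  with φ-surjective S S≠
    ...   | i₀ , refl = trans
      (∑-cong (allFin d) (λ i → δ-cong _≟ₛ_ Fin._≟_ (φ i) (φ i₀) i i₀ (φ-injective i i₀) (cong φ)))
      (allFin-enumerates d i₀)
    preimages S | false = ∑-zero (allFin d) _ λ i → Mₛ.δ-≢ λ φi≡S →
      true≢false (trans (sym (nonempty-φ i)) (trans (cong nonempty φi≡S) S≠))

  ∑-φ : ∀ (g : Subset (order G) → ℕ) → ∑ (allFin d) (g ∘ φ) ≡ ∑⁺ g
  ∑-φ g = begin
    ∑ (allFin d) (g ∘ φ)                                     ≡⟨ sym (∑-map φ (allFin d) g) ⟩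
    ∑ (map φ (allFin d)) g
      ≡⟨ Mₛ.∑-by-multiplicity (allSubsets (order G)) (allSubsets-enumerates (order G)) (map φ (allFin d)) g ⟩
    ∑ (allSubsets (order G)) (λ S → Mₛ.multiplicity S (map φ (allFin d)) * g S)
                                                             ≡⟨ ∑-cong (allSubsets (order G)) (λ S → cong (_* g S) (multiplicity-φ S)) ⟩
    ∑⁺ g                                                     ∎
    where open ≡-Reasoning

  rowSum-power : ∀ j i → sumFin (λ i′ → (A ^^ j) i i′) ≡ walks j (φ i)
  rowSum-power zero    i = trans (∑-cong (allFin d) (M.δ-sym i)) (allFin-enumerates d i)
  rowSum-power (suc j) i = begin
    sumFin (λ i′ → sumFin (λ l → A i l * (A ^^ j) l i′))    ≡⟨ ∑-comm (allFin d) (allFin d) _ ⟩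
    sumFin (λ l → sumFin (λ i′ → A i l * (A ^^ j) l i′))    ≡⟨ ∑-cong (allFin d) (λ l → ∑-*ˡ (allFin d) (A i l) _) ⟩
    sumFin (λ l → A i l * sumFin (λ i′ → (A ^^ j) l i′))    ≡⟨ ∑-cong (allFin d) (λ l → cong (A i l *_) (rowSum-power j l)) ⟩
    sumFin (λ l → 𝟙 (linked G (φ i) (φ l)) * walks j (φ l)) ≡⟨ ∑-φ (λ T → 𝟙 (linked G (φ i) T) * walks j T) ⟩
    walks (suc j) (φ i)                                     ∎
    where open ≡-Reasoning

  onesForm-power : ∀ j → onesForm (A ^^ j) ≡ totalWalks j
  onesForm-power j = trans (∑-cong (allFin d) (rowSum-power j)) (∑-φ (walks j))

module _ (G : Graph) (n : ℕ) where
  open Columns G n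
  open Words G using (isLWord)
  open CountingLWords G
  private
    m : ℕ
    m = order G

  ∑-columns : ∀ (h : Vec (Subset m) n → ℕ) →
              ∑ (allSubsets (m * n)) (h ∘ columns) ≡ ∑ (allVecs _≟ₛ_ (allSubsets m) n) h
  ∑-columns h = trans (sym (∑-map columns (allSubsets (m * n)) h))
    (Multiplicity.∑-enumeration (Vec.≡-dec _≟ₛ_) (allVecs _≟ₛ_ (allSubsets m) n) (map columns (allSubsets (m * n)))
      (allVecs-enumerates _≟ₛ_ (allSubsets-enumerates m) n)
      (map-enumerates _≟ₛ_ (Vec.≡-dec _≟ₛ_) columns-↔ {allSubsets (m * n)} (allSubsets-enumerates (m * n))) h)

  NL≡walk-counts : NL G n ≡ n * N G + ∑ (upTo n) walksUpTo
  NL≡walk-counts = begin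
    NL G n                                                ≡⟨ count≡∑ (isLConnectedSet G n) ⟩
    ∑ (allSubsets (m * n)) (𝟙 ∘ isLConnectedSet G n)      ≡⟨ ∑-cong (allSubsets (m * n)) (cong 𝟙 ∘ LConnected.isLConnectedSet≡isLWord G n) ⟩
    ∑ (allSubsets (m * n)) (𝟙 ∘ isLWord ∘ columns)        ≡⟨ ∑-columns (𝟙 ∘ isLWord) ⟩
    #words n isLWord                                      ≡⟨ #isLWord n ⟩
    n * ∑⁺ (𝟙 ∘ connected G) + ∑ (upTo n) walksUpTo       ≡⟨ cong (λ k → n * k + ∑ (upTo n) walksUpTo) ∑⁺-connected ⟩
    n * N G + ∑ (upTo n) walksUpTo                        ∎
    where open ≡-Reasoning

NL≤NProd : ∀ G n → NL G n ≤ NProd G n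
NL≤NProd G n = subst₂ _≤_ (sym (count≡∑ (isLConnectedSet G n))) (sym (count≡∑ (isConnectedSet (prodAdj G n))))
  (∑-mono-≤ (allSubsets (order G * n)) (λ C → 𝟙-∧-≤ (isConnectedSet (prodAdj G n) C) _))

NL-formula : ∀ G n {d} (φ : Fin d → Subset (order G)) → IsEnumeration φ →
  NL G n ≡ n * N G + sumFromTo 2 n (λ k → (n ∸ k + 1) * onesForm (matA G φ ^^ (k ∸ 1)))
NL-formula G n φ φ-enum = trans (NL≡walk-counts G n) (cong (n * N G +_) (sym (trans
  (∑-cong (drop 2 (upTo (suc n))) (λ k → cong ((n ∸ k + 1) *_) (AdjacencyMatrix.onesForm-power G φ φ-enum (k ∸ 1))))
  (sumFromTo-weighted (CountingLWords.totalWalks G) n))))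

-- The equality case

module _ (G : Graph) where
  private
    m : ℕ
    m = order G

  IsComplete? : Dec (IsComplete G)
  IsComplete? = all? λ x → all? λ z → ¬? (x Fin.≟ z) →-dec (adj G x z Bool.≟ true)

  nonadjacent-pair : ¬ IsComplete G → ∃₂ λ x z → ¬ x ≡ z × adj G x z ≡ false
  nonadjacent-pair incomplete
    with ¬∀⟶∃¬ m _ (λ x → all? λ z → ¬? (x Fin.≟ z) →-dec (adj G x z Bool.≟ true)) incomplete
  ... | x , ¬∀z with ¬∀⟶∃¬ m _ (λ z → ¬? (x Fin.≟ z) →-dec (adj G x z Bool.≟ true)) ¬∀z
  ...   | z , ¬x≁z =
    x , z , (λ x≡z → ¬x≁z (λ x≢z → contradiction x≡z x≢z)) , ¬true⇒false (λ xz → ¬x≁z (λ _ → xz))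

  -- On a walk from x to a non-neighbour, some neighbour of x is followed by a vertex other than x
  -- that is not adjacent to x.
  induced-P₃ : IsConnected G → ¬ IsComplete G →
               ∃ λ x → ∃₂ λ y z → adj G x y ≡ true × adj G y z ≡ true × adj G x z ≡ false × ¬ x ≡ z
  induced-P₃ G-connected incomplete with nonadjacent-pair incomplete
  ... | x , z , x≢z , x≁z =
    x , first-step (proj₂ (isConnectedSet⇒ConnectedSet (adj G) V G-connected) x z (V-full x) (V-full z)) x≁z x≢z
    where
    V : Subset m
    V = tabulate (λ _ → true)
    V-full : ∀ p → mem V p ≡ true
    V-full = lookup∘tabulate _
    first-step : ∀ {t} → Walk (adj G) V x t → adj G x t ≡ false → ¬ x ≡ t →
                 ∃₂ λ y z → adj G x y ≡ true × adj G y z ≡ true × adj G x z ≡ false × ¬ x ≡ z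
    first-step []                    _   x≢x = contradiction refl x≢x
    first-step {t} (step {s} w st _) x≁t x≢t with s Fin.≟ x
    ... | yes refl = contradiction (trans (sym st) x≁t) true≢false
    ... | no  s≢x with adj G x s in xs
    ...   | true  = s , t , xs , st , x≁t , x≢t
    ...   | false = first-step w xs (s≢x ∘ sym)

  ¬linked-nonadjacent-rows : ∀ {x z S T} → adj G x z ≡ false → ¬ x ≡ z →
    (∀ p → mem S p ≡ true → p ≡ x ⊎ p ≡ z) → (∀ p → mem T p ≡ true → p ≡ x ⊎ p ≡ z) →
    mem S x ≡ true → mem S z ≡ true → linked G S T ≡ false
  ¬linked-nonadjacent-rows {x} {z} {S} {T} x≁z x≢z S⊆ T⊆ x∈S z∈S =
    ¬true⇒false λ linked-ST → x≢z (sym (row-x (walk-x-z linked-ST)))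
    where
    D : Subset (m * 2)
    D = twoColumns G S T
    in-rows : ∀ p e → mem D (combine p e) ≡ true → p ≡ x ⊎ p ≡ z
    in-rows p Fin.zero           p∈ = S⊆ p (trans (sym (mem-twoColumns₀ G S T p)) p∈)
    in-rows p (Fin.suc Fin.zero) p∈ = T⊆ p (trans (sym (mem-twoColumns₁ G S T p)) p∈)
    no-x-z-edge : ∀ e e′ → prodAdj G 2 (combine x e) (combine z e′) ≡ false
    no-x-z-edge e e′ rewrite prodAdj-combine G 2 x z e e′ | x≁z | ⌊⌋-false⁺ (x Fin.≟ z) x≢z = refl
    stays-in-row-x : ∀ {e₀ b} → Walk (prodAdj G 2) D (combine x e₀) b → ∃ λ e → b ≡ combine x e
    stays-in-row-x {e₀} [] = e₀ , refl
    stays-in-row-x {b = b} (step w ab b∈) with stays-in-row-x w | coordinates {m} {2} b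
    ... | e , refl | p , e′ , refl with in-rows p e′ b∈
    ...   | inj₁ refl = e′ , refl
    ...   | inj₂ refl = contradiction (trans (sym ab) (no-x-z-edge e e′)) true≢false
    walk-x-z : linked G S T ≡ true → Walk (prodAdj G 2) D (combine x Fin.zero) (combine z Fin.zero)
    walk-x-z linked-ST = proj₂ (isConnectedSet⇒ConnectedSet (prodAdj G 2) D linked-ST) _ _
      (trans (mem-twoColumns₀ G S T x) x∈S) (trans (mem-twoColumns₀ G S T z) z∈S)
    row-x : Walk (prodAdj G 2) D (combine x Fin.zero) (combine z Fin.zero) → z ≡ x
    row-x w with stays-in-row-x w
    ... | e , z≡x = proj₁ (combine-injective z Fin.zero x e z≡x)

-- For n ≥ 3, the columns {x, z}, {x, z}, {x, y, z} form a connected set of G × P_n that is not in 𝒞_L.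
module InducedP₃Counterexample (G : Graph) (n′ : ℕ) {x y z : Fin (order G)}
  (xy : adj G x y ≡ true) (yz : adj G y z ≡ true) (x≁z : adj G x z ≡ false) (x≢z : ¬ x ≡ z) where
  private
    m n : ℕ
    m = order G
    n = 3 + n′
    H : Adj (m * n)
    H = prodAdj G n
    c₀ c₁ c₂ : Fin n
    c₀ = Fin.zero
    c₁ = Fin.suc Fin.zero
    c₂ = Fin.suc (Fin.suc Fin.zero)
  open Columns G n
  open Words G using (LWord)

  isXZ : Fin m → Bool
  isXZ p = ⌊ p Fin.≟ x ⌋ ∨ ⌊ p Fin.≟ z ⌋

  isXYZ : Fin m → Bool
  isXYZ p = ⌊ p Fin.≟ y ⌋ ∨ isXZ p

  rows : Fin n → Fin m → Bool
  rows Fin.zero                         = isXZ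
  rows (Fin.suc Fin.zero)               = isXZ
  rows (Fin.suc (Fin.suc Fin.zero))     = isXYZ
  rows (Fin.suc (Fin.suc (Fin.suc _))) _ = false

  C₀ : Subset (m * n)
  C₀ = tabulate (λ a → rows (proj₂ (remQuot {m} n a)) (proj₁ (remQuot {m} n a)))

  mem-C₀ : ∀ p c → mem C₀ (combine p c) ≡ rows c p
  mem-C₀ p c = trans (lookup∘tabulate _ (combine p c)) (cong (λ q → rows (proj₂ q) (proj₁ q)) (remQuot-combine {m} {n} p c))

  isXZ⁻ : ∀ {p} → isXZ p ≡ true → p ≡ x ⊎ p ≡ z
  isXZ⁻ {p} e with ∨-true⁻ ⌊ p Fin.≟ x ⌋ e
  ... | inj₁ p≡x = inj₁ (⌊⌋-true⁻ (p Fin.≟ x) p≡x)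
  ... | inj₂ p≡z = inj₂ (⌊⌋-true⁻ (p Fin.≟ z) p≡z)

  isXZ⁺ : ∀ {p} → p ≡ x ⊎ p ≡ z → isXZ p ≡ true
  isXZ⁺ (inj₁ refl) = ∨-trueˡ _ (⌊⌋-true⁺ (x Fin.≟ x) refl)
  isXZ⁺ {p} (inj₂ refl) = ∨-trueʳ ⌊ p Fin.≟ x ⌋ (⌊⌋-true⁺ (z Fin.≟ z) refl)

  hub : Fin (m * n)
  hub = combine y c₂

  hub∈C₀ : mem C₀ hub ≡ true
  hub∈C₀ = trans (mem-C₀ y c₂) (∨-trueˡ _ (⌊⌋-true⁺ (y Fin.≟ y) refl))

  vertical : ∀ p {c c′} → pathAdj n c c′ ≡ true → H (combine p c) (combine p c′) ≡ true
  vertical p {c} {c′} up = trans (prodAdj-combine G n p p c c′)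
    (∨-trueʳ (adj G p p ∧ ⌊ c Fin.≟ c′ ⌋) (∧-true⁺ (⌊⌋-true⁺ (p Fin.≟ p) refl) up))

  climb-to-hub : ∀ {p} → p ≡ x ⊎ p ≡ z → ∀ c → rows c p ≡ true → Walk H C₀ (combine p c) hub
  climb-to-hub {p} xz = go
    where
    across : H (combine p c₂) hub ≡ true
    across = trans (prodAdj-combine G n p y c₂ c₂)
      (∨-trueˡ _ (∧-true⁺ (neighbour xz) (⌊⌋-true⁺ (c₂ Fin.≟ c₂) refl)))
      where
      neighbour : p ≡ x ⊎ p ≡ z → adj G p y ≡ true
      neighbour (inj₁ refl) = xy
      neighbour (inj₂ refl) = trans (Graph.sym G z y) yz
    in-row : ∀ c → rows c p ≡ true → mem C₀ (combine p c) ≡ true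
    in-row c e = trans (mem-C₀ p c) e
    from-c₂ : Walk H C₀ (combine p c₂) hub
    from-c₂ = step [] across hub∈C₀
    from-c₁ : Walk H C₀ (combine p c₁) hub
    from-c₁ = step [] (vertical p refl) (in-row c₂ (∨-trueʳ ⌊ p Fin.≟ y ⌋ (isXZ⁺ xz))) ++ʷ from-c₂
    go : ∀ c → rows c p ≡ true → Walk H C₀ (combine p c) hub
    go Fin.zero                     _ = step [] (vertical p refl) (in-row c₁ (isXZ⁺ xz)) ++ʷ from-c₁
    go (Fin.suc Fin.zero)           _ = from-c₁
    go (Fin.suc (Fin.suc Fin.zero)) _ = from-c₂

  to-hub : ∀ a → mem C₀ a ≡ true → Walk H C₀ a hub
  to-hub a a∈ with coordinates {m} {n} a
  ... | p , c , refl = from-row c (trans (sym (mem-C₀ p c)) a∈)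
    where
    from-row : ∀ c → rows c p ≡ true → Walk H C₀ (combine p c) hub
    from-row Fin.zero                     e = climb-to-hub (isXZ⁻ e) Fin.zero e
    from-row (Fin.suc Fin.zero)           e = climb-to-hub (isXZ⁻ e) c₁ e
    from-row (Fin.suc (Fin.suc Fin.zero)) e with ∨-true⁻ ⌊ p Fin.≟ y ⌋ e
    ... | inj₁ p≡y with ⌊⌋-true⁻ (p Fin.≟ y) p≡y
    ...   | refl = []
    from-row (Fin.suc (Fin.suc Fin.zero)) e | inj₂ xz = climb-to-hub (isXZ⁻ xz) c₂ e

  C₀-connected : isConnectedSet H C₀ ≡ true
  C₀-connected = ConnectedSet⇒isConnectedSet H C₀
    ((hub , hub∈C₀) , λ a b a∈ b∈ → to-hub a a∈ ++ʷ reverseʷ (prodAdj-sym G n) b∈ (to-hub b b∈))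

  mem-columnWord : ∀ c p → mem (columnWord C₀ (toℕ c)) p ≡ rows c p
  mem-columnWord c p = trans (cong (λ S → mem S p) (columnWord-toℕ C₀ c)) (trans (mem-column C₀ c p) (mem-C₀ p c))

  first-columns-not-linked : linked G (columnWord C₀ 0) (columnWord C₀ 1) ≡ false
  first-columns-not-linked = ¬linked-nonadjacent-rows G x≁z x≢z
    (λ p e → isXZ⁻ (trans (sym (mem-columnWord c₀ p)) e)) (λ p e → isXZ⁻ (trans (sym (mem-columnWord c₁ p)) e))
    (trans (mem-columnWord c₀ x) (isXZ⁺ (inj₁ refl))) (trans (mem-columnWord c₀ z) (isXZ⁺ (inj₂ refl)))

  C₀-not-L : isLConnectedSet G n C₀ ≡ false
  C₀-not-L = ¬true⇒false λ C₀-L →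
    true≢false (trans (sym (LWord.linked-suc (LConnected.isLConnectedSet⇒LWord G n C₀ C₀-L) 0 W₀ W₁))
                      first-columns-not-linked)
    where
    W₀ : nonempty (columnWord C₀ 0) ≡ true
    W₀ = nonempty⁺ (columnWord C₀ 0) x (trans (mem-columnWord c₀ x) (isXZ⁺ (inj₁ refl)))
    W₁ : nonempty (columnWord C₀ 1) ≡ true
    W₁ = nonempty⁺ (columnWord C₀ 1) x (trans (mem-columnWord c₁ x) (isXZ⁺ (inj₁ refl)))

  NL<NProd : NL G n < NProd G n
  NL<NProd = subst₂ _<_ (sym (count≡∑ (isLConnectedSet G n))) (sym (count≡∑ (isConnectedSet H)))
    (∑-mono-< (allSubsets (m * n)) (λ C → 𝟙-∧-≤ (isConnectedSet H C) _)
              (Multiplicity.Enumerates⇒∈ _≟ₛ_ (allSubsets-enumerates (m * n)) C₀)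
              (subst₂ (λ a b → 𝟙 a < 𝟙 b) (sym C₀-not-L) (sym C₀-connected) (s≤s z≤n)))

NProd≡NL⇒ : ∀ G → IsConnected G → ∀ n → n ≥ 1 → NProd G n ≡ NL G n → IsComplete G ⊎ n ≡ 1 ⊎ n ≡ 2
NProd≡NL⇒ G _ 1 _ _ = inj₂ (inj₁ refl)
NProd≡NL⇒ G _ 2 _ _ = inj₂ (inj₂ refl)
NProd≡NL⇒ G G-connected (suc (suc (suc n′))) _ NProd≡NL with IsComplete? G
... | yes complete   = inj₁ complete
... | no  incomplete with induced-P₃ G G-connected incomplete
...   | x , y , z , xy , yz , x≁z , x≢z =
  contradiction (sym NProd≡NL) (<⇒≢ (InducedP₃Counterexample.NL<NProd G n′ xy yz x≁z x≢z))

theorem1p1 : (G : Graph) → IsConnected G → (n : ℕ) → n ≥ 1 →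
    (NL G n ≤ NProd G n)
    × ((φ : Fin (2 ^ order G ∸ 1) → Subset (order G)) → IsEnumeration φ →
         NL G n ≡ n * N G
                  + sumFromTo 2 n (λ k → (n ∸ k + 1) * onesForm (matA G φ ^^ (k ∸ 1))))
    × (NProd G n ≡ NL G n → IsComplete G ⊎ n ≡ 1 ⊎ n ≡ 2)
theorem1p1 G G-connected n n≥1 = NL≤NProd G n , NL-formula G n , NProd≡NL⇒ G G-connected n n≥1
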